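{- Let $\mathcal V(x)=\sum_n|\mathcal V_n|x^n$, $\mathbf V(x)=\sum_nx^n\sum_{p\in\mathcal V_n}\overline d(p)$, $\mathcal N(x)=\sum_n|\mathcal N_n|x^n$, $\mathbf N(x)=\sum_nx^n\sum_{p\in\mathcal N_n}\overline d(p)$, $\mathcal M(x,1)=\sum_n|\mathcal M_n|x^n$, $\mathbf M(x,1)=\sum_nx^n\sum_{p\in\mathcal M_n}\overline d(p)$. Then \begin{align*}\mathbf V(x)&=2x\mathbf V(x)+2x^2\mathbf M(x,1)\mathcal V(x)+2x^2\mathcal M(x,1)\mathbf V(x)+2x^2\mathcal V(x)\tfrac{\partial}{\partial x}\big(x\mathcal M(x,1)\big)\\&\quad+2x\mathbf N(x)+2x\tfrac{\partial}{\partial x}\big(x\mathcal N(x)\big),\end{align*} and explicitly \[\mathbf V(x)=\frac{8x\left(1+\sqrt{1-4x}-x(3+\sqrt{1-4x})\right)}{(1-4x)(1-4x+\sqrt{1-4x})^3}.\]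
   Context: Steps: $U=(1,1)$, $D=(1,-1)$, and two distinguishable horizontal steps $O_1,O_2$, each $(1,0)$. $\mathcal V_n$ is the set of all lattice paths with $n$ steps from $\{U,D,O_1,O_2\}$ starting at $(0,0)$; $\mathcal N_n$ is the subset staying weakly above the $x$-axis; $\mathcal M_n\subseteq\mathcal N_n$ is the subset that moreover ends on the $x$-axis. For a path $r$ with heights $r_0,\dots,r_n$, $\overline d(r)=\sum_{i=0}^n|r_i|$. -}

module Defs where

open import Data.Nat as ℕ using (ℕ; zero; suc; _∸_)
open import Data.Integer as ℤ using (ℤ; +_; _+_; _-_; _*_; ∣_∣; _≤ᵇ_)
open import Data.Bool using (Bool; true; false; _∧_; if_then_else_)
open import Data.List as List using (List; []; _∷_; map; concatMap; upTo; foldr)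
open import Data.Vec as Vec using (Vec; []; _∷_)
open import Data.Product using (_×_)
open import Relation.Binary.PropositionalEquality using (_≡_)

data Step : Set where
  U D O₁ O₂ : Step

allSteps : List Step
allSteps = U ∷ D ∷ O₁ ∷ O₂ ∷ []

Δ : Step → ℤ
Δ U  = + 1
Δ D  = ℤ.- (+ 1)
Δ O₁ = + 0
Δ O₂ = + 0

-- all words of n steps (= all paths in 𝒱ₙ, starting at (0,0))
allPaths : (n : ℕ) → List (Vec Step n)
allPaths zero    = [] ∷ []
allPaths (suc n) = concatMap (λ s → map (s ∷_) (allPaths n)) allSteps

heightsFrom : {n : ℕ} → ℤ → Vec Step n → List ℤ
heightsFrom h []       = h ∷ []
heightsFrom h (s ∷ p)  = h ∷ heightsFrom (h + Δ s) p

heights : {n : ℕ} → Vec Step n → List ℤ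
heights = heightsFrom (+ 0)

finalHeightFrom : {n : ℕ} → ℤ → Vec Step n → ℤ
finalHeightFrom h []      = h
finalHeightFrom h (s ∷ p) = finalHeightFrom (h + Δ s) p

dbar : {n : ℕ} → Vec Step n → ℕ
dbar p = foldr ℕ._+_ 0 (map ∣_∣ (heights p))

isN : {n : ℕ} → Vec Step n → Bool
isN p = foldr (λ r b → (+ 0 ≤ᵇ r) ∧ b) true (heights p)

endsOnAxis : {n : ℕ} → Vec Step n → Bool
endsOnAxis p = (finalHeightFrom (+ 0) p ≤ᵇ + 0) ∧ (+ 0 ≤ᵇ finalHeightFrom (+ 0) p)

isM : {n : ℕ} → Vec Step n → Bool
isM p = isN p ∧ endsOnAxis p

Series : Set
Series = ℕ → ℤ

sumℤ : List ℤ → ℤ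
sumℤ = foldr _+_ (+ 0)

countWhere : (∀ {n} → Vec Step n → Bool) → Series
countWhere P n = sumℤ (map (λ p → if P p then + 1 else + 0) (allPaths n))

dbarWhere : (∀ {n} → Vec Step n → Bool) → Series
dbarWhere P n = sumℤ (map (λ p → if P p then + dbar p else + 0) (allPaths n))

allTrue : {n : ℕ} → Vec Step n → Bool
allTrue _ = true

𝒱 : Series
𝒱 = countWhere allTrue
𝐕 : Series
𝐕 = dbarWhere allTrue
𝒩 : Series
𝒩 = countWhere isN
𝐍 : Series
𝐍 = dbarWhere isN
ℳ₁ : Series
ℳ₁ = countWhere isM
𝐌₁ : Series
𝐌₁ = dbarWhere isM

_⊕_ : Series → Series → Series
(f ⊕ g) n = f n + g n

_⊖_ : Series → Series → Series
(f ⊖ g) n = f n - g n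

_⊛_ : Series → Series → Series
(f ⊛ g) n = sumℤ (map (λ k → f k * g (n ∸ k)) (upTo (suc n)))

infixl 6 _⊕_ _⊖_
infixl 7 _⊛_ _·_
infix 4 _≐_

_·_ : ℤ → Series → Series
(c · f) n = c * f n

X : Series → Series
X f zero    = + 0
X f (suc n) = f n

const : ℤ → Series
const c zero    = c
const c (suc n) = + 0

∂ : Series → Series
∂ f n = + (suc n) * f (suc n)

_≐_ : Series → Series → Set
f ≐ g = ∀ n → f n ≡ g n

oneMinus4x : Series
oneMinus4x = const (+ 1) ⊖ (+ 4) · X (const (+ 1))

IsSqrt1m4x : Series → Set
IsSqrt1m4x S = (S 0 ≡ + 1) × (S ⊛ S ≐ oneMinus4x)

{-# OPTIONS --safe #-}
-- Classify a path by its first step. U and D contribute equally by mirror symmetry, and a path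
-- started at height 1 either stays at height ≥ 1 — a lifted 𝒩-path, whose d̄ exceeds that of the
-- 𝒩-path by n + 1 — or is a lifted ℳ-path, a step D back to the axis and an arbitrary path.
-- Summing d̄ over this first-passage decomposition, coefficientwise by induction on the length and
-- simultaneously for all starting heights, gives the functional equation.
--
-- For the closed form, adding one step to a path multiplies the count by 4 and adds the final
-- height, so (1 - 4x) 𝐕 = E and (1 - 4x) E = 2x B, where E sums the final |height| and B counts the
-- bridges (paths from the axis back to it). First passage also gives B = 1 + 2xB + 2x²ℳB and
-- ℳ = 1 + 2xℳ + x²ℳ², so 1 - 2x - 2x²ℳ is the unique square root S of 1 - 4x with constant term 1,
-- and S B = 1. Hence S⁵ 𝐕 = S (1 - 4x)² 𝐕 = 2x, and the stated identity follows from S² = 1 - 4x.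
module Submission where

open import Defs
open import Data.Nat as ℕ using (ℕ; zero; suc; _∸_; _<_; z≤n; s≤s)
import Data.Nat.Properties as ℕ
import Data.Nat.Tactic.RingSolver as ℕ-Solver
open import Data.Integer as ℤ using (ℤ; +_; -[1+_]; _+_; _*_; ∣_∣; _≤ᵇ_)
import Data.Integer.Properties as ℤ
open import Data.Integer.Tactic.RingSolver using (solve-∀)
open import Data.Bool using (Bool; true; false; _∧_; if_then_else_)
open import Data.Bool.Properties using (∧-identityʳ; ∧-zeroʳ)
open import Data.List using (List; []; _∷_; map; concatMap; applyUpTo; foldr; _++_)
open import Data.Vec using (Vec; []; _∷_)
open import Data.Product using (Σ; _×_; _,_; ∃)
open import Data.Sum using (inj₁; inj₂)
open import Data.Empty using (⊥-elim)
open import Data.Maybe using (Maybe; just; nothing)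
open import Function using (_∘_; id)
open import Relation.Binary.PropositionalEquality
open import Data.Nat.Induction using (<-rec)
open import Relation.Binary.Structures using (IsEquivalence)
import Relation.Binary.Reasoning.Setoid
open import Relation.Nullary using (yes; no)
open import Algebra.Structures.Biased using (IsCommutativeSemiringˡ)
open import Algebra.Solver.Ring.AlmostCommutativeRing
  using (AlmostCommutativeRing; _-Raw-AlmostCommutative⟶_)

-- Finite sums

module _ {A : Set} where

  sumℤ-++ : (f : A → ℤ) (xs ys : List A) →
            sumℤ (map f (xs ++ ys)) ≡ sumℤ (map f xs) + sumℤ (map f ys)
  sumℤ-++ f []       ys = sym (ℤ.+-identityˡ _)
  sumℤ-++ f (x ∷ xs) ys = trans (cong (_+_ (f x)) (sumℤ-++ f xs ys)) (sym (ℤ.+-assoc (f x) _ _))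

  sumℤ-+ : (f g : A → ℤ) (xs : List A) →
           sumℤ (map (λ x → f x + g x) xs) ≡ sumℤ (map f xs) + sumℤ (map g xs)
  sumℤ-+ f g []       = refl
  sumℤ-+ f g (x ∷ xs) = trans (cong (_+_ (f x + g x)) (sumℤ-+ f g xs)) (interchange (f x) (g x) _ _)
    where
    interchange : ∀ a b c d → (a + b) + (c + d) ≡ (a + c) + (b + d)
    interchange = solve-∀

  sumℤ-*ˡ : (c : ℤ) (f : A → ℤ) (xs : List A) →
            sumℤ (map (λ x → c * f x) xs) ≡ c * sumℤ (map f xs)
  sumℤ-*ˡ c f []       = sym (ℤ.*-zeroʳ c)
  sumℤ-*ˡ c f (x ∷ xs) = trans (cong (_+_ (c * f x)) (sumℤ-*ˡ c f xs)) (sym (ℤ.*-distribˡ-+ c (f x) _))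

  sumℤ-cong : {f g : A → ℤ} → (∀ x → f x ≡ g x) → (xs : List A) →
              sumℤ (map f xs) ≡ sumℤ (map g xs)
  sumℤ-cong f≗g []       = refl
  sumℤ-cong f≗g (x ∷ xs) = cong₂ _+_ (f≗g x) (sumℤ-cong f≗g xs)

  sumℤ-zero : (xs : List A) → sumℤ (map (λ _ → + 0) xs) ≡ + 0
  sumℤ-zero []       = refl
  sumℤ-zero (x ∷ xs) = trans (ℤ.+-identityˡ _) (sumℤ-zero xs)

module _ {A B : Set} where

  sumℤ-map : (f : B → ℤ) (g : A → B) (xs : List A) →
             sumℤ (map f (map g xs)) ≡ sumℤ (map (f ∘ g) xs)
  sumℤ-map f g []       = refl
  sumℤ-map f g (x ∷ xs) = cong (_+_ (f (g x))) (sumℤ-map f g xs)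

  sumℤ-concatMap : (f : B → ℤ) (g : A → List B) (xs : List A) →
                   sumℤ (map f (concatMap g xs)) ≡ sumℤ (map (λ x → sumℤ (map f (g x))) xs)
  sumℤ-concatMap f g []       = refl
  sumℤ-concatMap f g (x ∷ xs) =
    trans (sumℤ-++ f (g x) (concatMap g xs)) (cong (_+_ (sumℤ (map f (g x)))) (sumℤ-concatMap f g xs))

sumBelow : (ℕ → ℤ) → ℕ → ℤ
sumBelow f zero    = + 0
sumBelow f (suc n) = f 0 + sumBelow (f ∘ suc) n

sumBelow-cong : ∀ {f g : ℕ → ℤ} n → (∀ k → k < n → f k ≡ g k) → sumBelow f n ≡ sumBelow g n
sumBelow-cong zero    f≗g = refl
sumBelow-cong (suc n) f≗g =
  cong₂ _+_ (f≗g 0 (s≤s z≤n)) (sumBelow-cong n (λ k k<n → f≗g (suc k) (s≤s k<n)))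

sumBelow-+ : ∀ (f g : ℕ → ℤ) n → sumBelow (λ k → f k + g k) n ≡ sumBelow f n + sumBelow g n
sumBelow-+ f g zero    = refl
sumBelow-+ f g (suc n) = trans (cong (_+_ (f 0 + g 0)) (sumBelow-+ (f ∘ suc) (g ∘ suc) n)) (interchange (f 0) (g 0) _ _)
  where
  interchange : ∀ a b c d → (a + b) + (c + d) ≡ (a + c) + (b + d)
  interchange = solve-∀

sumBelow-*ˡ : ∀ c (f : ℕ → ℤ) n → sumBelow (λ k → c * f k) n ≡ c * sumBelow f n
sumBelow-*ˡ c f zero    = sym (ℤ.*-zeroʳ c)
sumBelow-*ˡ c f (suc n) = trans (cong (_+_ (c * f 0)) (sumBelow-*ˡ c (f ∘ suc) n)) (sym (ℤ.*-distribˡ-+ c (f 0) _))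

sumBelow-zero : ∀ n → sumBelow (λ _ → + 0) n ≡ + 0
sumBelow-zero zero    = refl
sumBelow-zero (suc n) = trans (ℤ.+-identityˡ _) (sumBelow-zero n)

sumBelow-suc : ∀ (f : ℕ → ℤ) n → sumBelow f (suc n) ≡ sumBelow f n + f n
sumBelow-suc f zero    = ℤ.+-comm (f 0) (+ 0)
sumBelow-suc f (suc n) = trans (cong (_+_ (f 0)) (sumBelow-suc (f ∘ suc) n)) (sym (ℤ.+-assoc (f 0) _ _))

sumBelow-reverse : ∀ (f : ℕ → ℤ) n → sumBelow f n ≡ sumBelow (λ k → f (n ∸ suc k)) n
sumBelow-reverse f zero    = refl
sumBelow-reverse f (suc n) = begin
  f 0 + sumBelow (f ∘ suc) n                    ≡⟨ cong (_+_ (f 0)) (sumBelow-reverse (f ∘ suc) n) ⟩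
  f 0 + sumBelow (λ k → f (suc (n ∸ suc k))) n  ≡⟨ cong (_+_ (f 0)) (sumBelow-cong n suc-∸) ⟩
  f 0 + sumBelow g n                            ≡⟨ ℤ.+-comm (f 0) _ ⟩
  sumBelow g n + f 0                            ≡⟨ cong (λ i → sumBelow g n + f i) (sym (ℕ.n∸n≡0 n)) ⟩
  sumBelow g n + g n                            ≡⟨ sym (sumBelow-suc g n) ⟩
  sumBelow g (suc n)                            ∎
  where
  open ≡-Reasoning
  g : ℕ → ℤ
  g k = f (n ∸ k)
  suc-∸ : ∀ k → k < n → f (suc (n ∸ suc k)) ≡ g k
  suc-∸ k k<n = cong f (sym (ℕ.+-∸-assoc 1 k<n))

sumℤ-applyUpTo : ∀ (f : ℕ → ℤ) (g : ℕ → ℕ) n → sumℤ (map f (applyUpTo g n)) ≡ sumBelow (f ∘ g) n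
sumℤ-applyUpTo f g zero    = refl
sumℤ-applyUpTo f g (suc n) = cong (_+_ (f (g 0))) (sumℤ-applyUpTo f (g ∘ suc) n)

conv : (ℕ → ℤ) → (ℕ → ℤ) → ℕ → ℤ
conv f g n = sumBelow (λ k → f k * g (n ∸ suc k)) n

X-⊛≡conv : ∀ f g n → X (f ⊛ g) n ≡ conv f g n
X-⊛≡conv f g zero    = refl
X-⊛≡conv f g (suc n) = sumℤ-applyUpTo (λ k → f k * g (n ∸ k)) id (suc n)

⊛≡conv : ∀ f g n → (f ⊛ g) n ≡ conv f g (suc n)
⊛≡conv f g n = X-⊛≡conv f g (suc n)

conv-comm : ∀ f g n → conv f g n ≡ conv g f n
conv-comm f g n = trans (sumBelow-reverse _ n) (sumBelow-cong n (λ k k<n →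
  trans (cong (λ i → f (n ∸ suc k) * g i) (reflect k<n)) (ℤ.*-comm (f (n ∸ suc k)) (g k))))
  where
  reflect : ∀ {k n} → k < n → n ∸ suc (n ∸ suc k) ≡ k
  reflect {k} {suc n} (s≤s k≤n) = ℕ.m∸[m∸n]≡n k≤n

conv-congˡ : ∀ {f f′} g n → (∀ k → f k ≡ f′ k) → conv f g n ≡ conv f′ g n
conv-congˡ g n f≗f′ = sumBelow-cong n (λ k _ → cong (_* g (n ∸ suc k)) (f≗f′ k))

conv-congʳ : ∀ f {g g′} n → (∀ k → g k ≡ g′ k) → conv f g n ≡ conv f g′ n
conv-congʳ f n g≗g′ = sumBelow-cong n (λ k _ → cong (f k *_) (g≗g′ (n ∸ suc k)))

conv-+ˡ : ∀ f f′ g n → conv (λ k → f k + f′ k) g n ≡ conv f g n + conv f′ g n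
conv-+ˡ f f′ g n = trans (sumBelow-cong n (λ k _ → ℤ.*-distribʳ-+ (g (n ∸ suc k)) (f k) (f′ k))) (sumBelow-+ _ _ n)

conv-*ˡ : ∀ c f g n → conv (λ k → c * f k) g n ≡ c * conv f g n
conv-*ˡ c f g n = trans (sumBelow-cong n (λ k _ → ℤ.*-assoc c (f k) _)) (sumBelow-*ˡ c _ n)

conv-zeroˡ : ∀ g n → conv (λ _ → + 0) g n ≡ + 0
conv-zeroˡ g n = trans (sumBelow-cong n (λ k _ → ℤ.*-zeroˡ (g (n ∸ suc k)))) (sumBelow-zero n)

conv-sumℤˡ : ∀ {A : Set} (F : A → ℕ → ℤ) (xs : List A) g n →
             conv (λ k → sumℤ (map (λ a → F a k) xs)) g n ≡ sumℤ (map (λ a → conv (F a) g n) xs)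
conv-sumℤˡ F []       g n = conv-zeroˡ g n
conv-sumℤˡ F (a ∷ xs) g n =
  trans (conv-+ˡ (F a) _ g n) (cong (_+_ (conv (F a) g n)) (conv-sumℤˡ F xs g n))

-- Formal power series

≐-refl : ∀ {f} → f ≐ f
≐-refl n = refl

≐-sym : ∀ {f g} → f ≐ g → g ≐ f
≐-sym f≐g n = sym (f≐g n)

≐-trans : ∀ {f g h} → f ≐ g → g ≐ h → f ≐ h
≐-trans f≐g g≐h n = trans (f≐g n) (g≐h n)

≐-isEquivalence : IsEquivalence _≐_
≐-isEquivalence = record
  { refl  = λ {f} → ≐-refl {f}
  ; sym   = λ {f} {g} → ≐-sym {f} {g}
  ; trans = λ {f} {g} {h} → ≐-trans {f} {g} {h}
  }

neg : Series → Series
neg f n = ℤ.- f n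

0ₛ 1ₛ xₛ : Series
0ₛ = const (+ 0)
1ₛ = const (+ 1)
xₛ = X 1ₛ

0ₛ-coeff : ∀ n → 0ₛ n ≡ + 0
0ₛ-coeff zero    = refl
0ₛ-coeff (suc n) = refl

⊕-cong : ∀ {f f′ g g′} → f ≐ f′ → g ≐ g′ → f ⊕ g ≐ f′ ⊕ g′
⊕-cong f≐f′ g≐g′ n = cong₂ _+_ (f≐f′ n) (g≐g′ n)

⊛-cong : ∀ {f f′ g g′} → f ≐ f′ → g ≐ g′ → f ⊛ g ≐ f′ ⊛ g′
⊛-cong {f} {f′} {g} {g′} f≐f′ g≐g′ n = begin
  (f ⊛ g) n           ≡⟨ ⊛≡conv f g n ⟩
  conv f g (suc n)    ≡⟨ conv-congˡ g (suc n) f≐f′ ⟩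
  conv f′ g (suc n)   ≡⟨ conv-congʳ f′ (suc n) g≐g′ ⟩
  conv f′ g′ (suc n)  ≡⟨ sym (⊛≡conv f′ g′ n) ⟩
  (f′ ⊛ g′) n         ∎
  where open ≡-Reasoning

⊛-comm : ∀ f g → f ⊛ g ≐ g ⊛ f
⊛-comm f g n = trans (⊛≡conv f g n) (trans (conv-comm f g (suc n)) (sym (⊛≡conv g f n)))

⊛-distribʳ : ∀ f f′ g → (f ⊕ f′) ⊛ g ≐ f ⊛ g ⊕ f′ ⊛ g
⊛-distribʳ f f′ g n = trans (⊛≡conv (f ⊕ f′) g n)
  (trans (conv-+ˡ f f′ g (suc n)) (sym (cong₂ _+_ (⊛≡conv f g n) (⊛≡conv f′ g n))))

·-⊛ : ∀ c f g → (c · f) ⊛ g ≐ c · (f ⊛ g)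
·-⊛ c f g n = trans (⊛≡conv (c · f) g n)
  (trans (conv-*ˡ c f g (suc n)) (sym (cong (c *_) (⊛≡conv f g n))))

const-⊛ : ∀ c f → const c ⊛ f ≐ c · f
const-⊛ c f n = trans (⊛≡conv (const c) f n)
  (trans (cong (_+_ (c * f n)) (conv-zeroˡ f n)) (ℤ.+-identityʳ _))

⊛-identityˡ : ∀ f → 1ₛ ⊛ f ≐ f
⊛-identityˡ f n = trans (const-⊛ (+ 1) f n) (ℤ.*-identityˡ (f n))

⊛-zeroˡ : ∀ f → 0ₛ ⊛ f ≐ 0ₛ
⊛-zeroˡ f n = trans (const-⊛ (+ 0) f n) (sym (0ₛ-coeff n))

⊛-unfoldˡ : ∀ f g → f ⊛ g ≐ f 0 · g ⊕ X ((f ∘ suc) ⊛ g)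
⊛-unfoldˡ f g zero    = ⊛≡conv f g 0
⊛-unfoldˡ f g (suc n) =
  trans (⊛≡conv f g (suc n)) (cong (_+_ (f 0 * g (suc n))) (sym (⊛≡conv (f ∘ suc) g n)))

X-⊛ : ∀ f g → X f ⊛ g ≐ X (f ⊛ g)
X-⊛ f g zero    = ⊛≡conv (X f) g 0
X-⊛ f g (suc n) = trans (⊛≡conv (X f) g (suc n)) (trans (ℤ.+-identityˡ _) (sym (⊛≡conv f g n)))

⊛-assoc : ∀ f g h → (f ⊛ g) ⊛ h ≐ f ⊛ (g ⊛ h)
⊛-assoc f g h n = begin
  ((f ⊛ g) ⊛ h) n                                 ≡⟨ ⊛-cong (⊛-unfoldˡ f g) (≐-refl {h}) n ⟩
  ((f 0 · g ⊕ X ((f ∘ suc) ⊛ g)) ⊛ h) n           ≡⟨ ⊛-distribʳ (f 0 · g) _ h n ⟩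
  ((f 0 · g) ⊛ h) n + (X ((f ∘ suc) ⊛ g) ⊛ h) n   ≡⟨ cong₂ _+_ (·-⊛ (f 0) g h n) (X-⊛ _ h n) ⟩
  f 0 * (g ⊛ h) n + X (((f ∘ suc) ⊛ g) ⊛ h) n     ≡⟨ cong (_+_ (f 0 * (g ⊛ h) n)) (X-assoc n) ⟩
  f 0 * (g ⊛ h) n + X ((f ∘ suc) ⊛ (g ⊛ h)) n     ≡⟨ sym (⊛-unfoldˡ f (g ⊛ h) n) ⟩
  (f ⊛ (g ⊛ h)) n                                 ∎
  where
  open ≡-Reasoning
  X-assoc : X (((f ∘ suc) ⊛ g) ⊛ h) ≐ X ((f ∘ suc) ⊛ (g ⊛ h))
  X-assoc zero    = refl
  X-assoc (suc m) = ⊛-assoc (f ∘ suc) g h m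

neg-⊛ : ∀ f g → neg f ⊛ g ≐ neg (f ⊛ g)
neg-⊛ f g n = trans (⊛-cong {neg f} {ℤ.- + 1 · f} (λ k → sym (ℤ.-1*i≡-i (f k))) (≐-refl {g}) n)
  (trans (·-⊛ (ℤ.- + 1) f g n) (ℤ.-1*i≡-i _))

seriesRing : AlmostCommutativeRing _ _
seriesRing = record
  { Carrier = Series ; _≈_ = _≐_ ; _+_ = _⊕_ ; _*_ = _⊛_ ; -_ = neg ; 0# = 0ₛ ; 1# = 1ₛ
  ; isAlmostCommutativeRing = record
    { isCommutativeSemiring = IsCommutativeSemiringˡ.isCommutativeSemiring (record
      { +-isCommutativeMonoid = record
        { isMonoid = record
          { isSemigroup = record
            { isMagma = record
              { isEquivalence = ≐-isEquivalence ; ∙-cong = λ {f} {f′} {g} {g′} → ⊕-cong {f} {f′} {g} {g′} }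
            ; assoc = λ f g h n → ℤ.+-assoc (f n) (g n) (h n) }
          ; identity = (λ f n → trans (cong (_+ f n) (0ₛ-coeff n)) (ℤ.+-identityˡ (f n)))
                     , (λ f n → trans (cong (_+_ (f n)) (0ₛ-coeff n)) (ℤ.+-identityʳ (f n))) }
        ; comm = λ f g n → ℤ.+-comm (f n) (g n) }
      ; *-isCommutativeMonoid = record
        { isMonoid = record
          { isSemigroup = record
            { isMagma = record
              { isEquivalence = ≐-isEquivalence ; ∙-cong = λ {f} {f′} {g} {g′} → ⊛-cong {f} {f′} {g} {g′} }
            ; assoc = ⊛-assoc }
          ; identity = ⊛-identityˡ , (λ f → ≐-trans {f ⊛ 1ₛ} (⊛-comm f 1ₛ) (⊛-identityˡ f)) }
        ; comm = ⊛-comm }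
      ; distribʳ = λ h f g → ⊛-distribʳ f g h
      ; zeroˡ = ⊛-zeroˡ })
    ; -‿cong = λ f≐g n → cong ℤ.-_ (f≐g n)
    ; -‿*-distribˡ = neg-⊛
    ; -‿+-comm = λ f g n → sym (ℤ.neg-distrib-+ (f n) (g n))
    }
  }

const-homomorphism : ℤ.+-*-rawRing -Raw-AlmostCommutative⟶ seriesRing
const-homomorphism = record
  { ⟦_⟧    = const
  ; +-homo = λ a b → λ { zero → refl ; (suc n) → refl }
  ; *-homo = λ a b → ≐-sym {const a ⊛ const b}
               (≐-trans {const a ⊛ const b} (const-⊛ a (const b)) (λ { zero → refl ; (suc n) → ℤ.*-zeroʳ a }))
  ; -‿homo = λ a → λ { zero → refl ; (suc n) → refl }
  ; 0-homo = λ { zero → refl ; (suc n) → refl }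
  ; 1-homo = λ { zero → refl ; (suc n) → refl }
  }

const-≟ : ∀ a b → Maybe (const a ≐ const b)
const-≟ a b with a ℤ.≟ b
... | yes refl = just ≐-refl
... | no _     = nothing

open import Algebra.Solver.Ring ℤ.+-*-rawRing seriesRing const-homomorphism const-≟
  using (solve; _:=_; _:+_; _:*_; :-_; con)

module ≐-Reasoning = Relation.Binary.Reasoning.Setoid (AlmostCommutativeRing.setoid seriesRing)

X≐xₛ⊛ : ∀ f → X f ≐ xₛ ⊛ f
X≐xₛ⊛ f n = sym (trans (X-⊛ 1ₛ f n) (X-identity n))
  where
  X-identity : X (1ₛ ⊛ f) ≐ X f
  X-identity zero    = refl
  X-identity (suc n) = ⊛-identityˡ f n

·≐const⊛ : ∀ c f → c · f ≐ const c ⊛ f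
·≐const⊛ c f n = sym (const-⊛ c f n)

-- Sums over paths

sumSteps : (Step → ℤ) → ℤ
sumSteps f = sumℤ (map f allSteps)

sumSteps-cong : ∀ {f g : Step → ℤ} → (∀ s → f s ≡ g s) → sumSteps f ≡ sumSteps g
sumSteps-cong f≗g = sumℤ-cong f≗g allSteps

sumSteps-+ : ∀ (f g : Step → ℤ) → sumSteps (λ s → f s + g s) ≡ sumSteps f + sumSteps g
sumSteps-+ f g = sumℤ-+ f g allSteps

sumSteps-+₃ : ∀ (f g h : Step → ℤ) → sumSteps (λ s → f s + g s + h s) ≡ sumSteps f + sumSteps g + sumSteps h
sumSteps-+₃ f g h = trans (sumSteps-+ (λ s → f s + g s) h) (cong (_+ sumSteps h) (sumSteps-+ f g))

sumPaths : (n : ℕ) → (Vec Step n → ℤ) → ℤ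
sumPaths n f = sumℤ (map f (allPaths n))

sumPaths-suc : ∀ n (f : Vec Step (suc n) → ℤ) →
               sumPaths (suc n) f ≡ sumSteps (λ s → sumPaths n (λ p → f (s ∷ p)))
sumPaths-suc n f = trans (sumℤ-concatMap f (λ s → map (s ∷_) (allPaths n)) allSteps)
                         (sumSteps-cong (λ s → sumℤ-map f (s ∷_) (allPaths n)))

sumPaths-cong : ∀ n {f g : Vec Step n → ℤ} → (∀ p → f p ≡ g p) → sumPaths n f ≡ sumPaths n g
sumPaths-cong n f≗g = sumℤ-cong f≗g (allPaths n)

sumPaths-zero : ∀ n → sumPaths n (λ _ → + 0) ≡ + 0
sumPaths-zero n = sumℤ-zero (allPaths n)

sumPaths-+ : ∀ n (f g : Vec Step n → ℤ) → sumPaths n (λ p → f p + g p) ≡ sumPaths n f + sumPaths n g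
sumPaths-+ n f g = sumℤ-+ f g (allPaths n)

sumPaths-*ˡ : ∀ n c (f : Vec Step n → ℤ) → sumPaths n (λ p → c * f p) ≡ c * sumPaths n f
sumPaths-*ˡ n c f = sumℤ-*ˡ c f (allPaths n)

sumPaths-const-+ : ∀ n c (f : Vec Step n → ℤ) → sumPaths n (λ p → c + f p) ≡ c * 𝒱 n + sumPaths n f
sumPaths-const-+ n c f = trans (sumPaths-+ n (λ _ → c) f) (cong (_+ sumPaths n f)
  (trans (sumPaths-cong n (λ _ → sym (ℤ.*-identityʳ c))) (sumPaths-*ˡ n c (λ _ → + 1))))

𝒱-suc : ∀ n → 𝒱 (suc n) ≡ + 4 * 𝒱 n
𝒱-suc n = trans (sumPaths-suc n (λ _ → + 1)) (four-copies (𝒱 n))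
  where
  four-copies : ∀ v → v + (v + (v + (v + + 0))) ≡ + 4 * v
  four-copies = solve-∀

mirrorStep : Step → Step
mirrorStep U  = D
mirrorStep D  = U
mirrorStep O₁ = O₁
mirrorStep O₂ = O₂

mirror : ∀ {n} → Vec Step n → Vec Step n
mirror []      = []
mirror (s ∷ p) = mirrorStep s ∷ mirror p

Δ-mirrorStep : ∀ s → Δ (mirrorStep s) ≡ ℤ.- Δ s
Δ-mirrorStep U  = refl
Δ-mirrorStep D  = refl
Δ-mirrorStep O₁ = refl
Δ-mirrorStep O₂ = refl

mirror-next-height : ∀ h s → ℤ.- h + Δ (mirrorStep s) ≡ ℤ.- (h + Δ s)
mirror-next-height h s = trans (cong (_+_ (ℤ.- h)) (Δ-mirrorStep s)) (sym (ℤ.neg-distrib-+ h (Δ s)))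

sumPaths-mirror : ∀ n (f : Vec Step n → ℤ) → sumPaths n (f ∘ mirror) ≡ sumPaths n f
sumPaths-mirror zero    f = refl
sumPaths-mirror (suc n) f = begin
  sumPaths (suc n) (f ∘ mirror)                              ≡⟨ sumPaths-suc n (f ∘ mirror) ⟩
  sumSteps (λ s → sumPaths n (λ p → f (mirrorStep s ∷ mirror p)))
    ≡⟨ sumSteps-cong (λ s → sumPaths-mirror n (λ p → f (mirrorStep s ∷ p))) ⟩
  sumSteps (λ s → sumPaths n (λ p → f (mirrorStep s ∷ p)))  ≡⟨ swap-first-two (part U) (part D) (part O₁) (part O₂) ⟩
  sumSteps part                                              ≡⟨ sym (sumPaths-suc n f) ⟩
  sumPaths (suc n) f                                         ∎
  where
  open ≡-Reasoning
  part : Step → ℤ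
  part s = sumPaths n (λ p → f (s ∷ p))
  swap-first-two : ∀ u d o o′ → d + (u + (o + (o′ + + 0))) ≡ u + (d + (o + (o′ + + 0)))
  swap-first-two = solve-∀

isNFrom : ∀ {n} → ℤ → Vec Step n → Bool
isNFrom h p = foldr (λ r b → (+ 0 ≤ᵇ r) ∧ b) true (heightsFrom h p)

isZero : ℤ → Bool
isZero i = (i ≤ᵇ + 0) ∧ (+ 0 ≤ᵇ i)

endsAtZeroFrom : ∀ {n} → ℤ → Vec Step n → Bool
endsAtZeroFrom h p = isZero (finalHeightFrom h p)

isMFrom : ∀ {n} → ℤ → Vec Step n → Bool
isMFrom h p = isNFrom h p ∧ endsAtZeroFrom h p

dbarFrom : ∀ {n} → ℤ → Vec Step n → ℕ
dbarFrom h p = foldr ℕ._+_ 0 (map ∣_∣ (heightsFrom h p))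

isNFrom-negative : ∀ k {n} (p : Vec Step n) → isNFrom -[1+ k ] p ≡ false
isNFrom-negative k []      = refl
isNFrom-negative k (s ∷ p) = refl

𝟙 : Bool → ℤ
𝟙 b = if b then + 1 else + 0

when : Bool → ℤ → ℤ
when b x = if b then x else + 0

when-+ : ∀ b a x → when b (a + x) ≡ a * 𝟙 b + when b x
when-+ true  a x = cong (_+ x) (sym (ℤ.*-identityʳ a))
when-+ false a x = sym (trans (ℤ.+-identityʳ (a * + 0)) (ℤ.*-zeroʳ a))

sumPaths-when-+ : ∀ n (b : Vec Step n → Bool) a (x : Vec Step n → ℤ) →
                  sumPaths n (λ p → when (b p) (a + x p))
                    ≡ a * sumPaths n (λ p → 𝟙 (b p)) + sumPaths n (λ p → when (b p) (x p))
sumPaths-when-+ n b a x = trans (sumPaths-cong n (λ p → when-+ (b p) a (x p)))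
  (trans (sumPaths-+ n _ _) (cong (_+ sumPaths n (λ p → when (b p) (x p))) (sumPaths-*ˡ n a _)))

-- First-passage decomposition

𝟙negative : ℤ → ℤ
𝟙negative (+ _)    = + 0
𝟙negative -[1+ _ ] = + 1

𝒩from ℳfrom : ℤ → ℕ → ℤ
𝒩from h n = sumPaths n (λ p → 𝟙 (isNFrom h p))
ℳfrom h n = sumPaths n (λ p → 𝟙 (isMFrom h p))

𝒩from-negative : ∀ k n → 𝒩from -[1+ k ] n ≡ + 0
𝒩from-negative k n = trans (sumPaths-cong n (λ p → cong 𝟙 (isNFrom-negative k p))) (sumPaths-zero n)

ℳfrom-negative : ∀ k n → ℳfrom -[1+ k ] n ≡ + 0
ℳfrom-negative k n =
  trans (sumPaths-cong n (λ p → cong (λ b → 𝟙 (b ∧ endsAtZeroFrom -[1+ k ] p)) (isNFrom-negative k p)))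
        (sumPaths-zero n)

conv-suc : ∀ f (F : Step → ℕ → ℤ) g n → (∀ k → f (suc k) ≡ sumSteps (λ s → F s k)) →
           conv f g (suc n) ≡ f 0 * g n + sumSteps (λ s → conv (F s) g n)
conv-suc f F g n f-suc = cong (_+_ (f 0 * g n)) (trans (conv-congˡ g n f-suc) (conv-sumℤˡ F allSteps g n))

ℳfrom-suc : ∀ j k → ℳfrom (+ j) (suc k) ≡ sumSteps (λ s → ℳfrom (+ j + Δ s) k)
ℳfrom-suc j k = sumPaths-suc k _

-- Only the step D from height 0 leaves the half-plane.
sumSteps-exits : ∀ j (f : Step → ℤ) → sumSteps (λ s → 𝟙negative (+ j + Δ s) * f s) ≡ ℳfrom (+ j) 0 * f D
sumSteps-exits zero    f = only-D (f U) (f D) (f O₁) (f O₂)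
  where
  only-D : ∀ u d o o′ → + 0 * u + (+ 1 * d + (+ 0 * o + (+ 0 * o′ + + 0))) ≡ + 1 * d
  only-D = solve-∀
sumSteps-exits (suc j) f = none (f U) (f D) (f O₁) (f O₂)
  where
  none : ∀ u d o o′ → + 0 * u + (+ 0 * d + (+ 0 * o + (+ 0 * o′ + + 0))) ≡ + 0 * d
  none = solve-∀

-- A path from height h either stays weakly above the axis, or is an ℳ-path from h to the axis,
-- a step D and an arbitrary path; conv accounts for the D step.
CountSplits : ℤ → ℕ → Set
CountSplits h n = 𝒱 n ≡ 𝒩from h n + conv (ℳfrom h) 𝒱 n

countSplits-anyHeight : ∀ n → (∀ j → CountSplits (+ j) n) →
                        ∀ h → 𝒱 n ≡ 𝒩from h n + conv (ℳfrom h) 𝒱 n + 𝟙negative h * 𝒱 n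
countSplits-anyHeight n splits (+ j) = trans (splits j)
  (sym (trans (cong (_+_ (𝒩from (+ j) n + conv (ℳfrom (+ j)) 𝒱 n)) (ℤ.*-zeroˡ (𝒱 n))) (ℤ.+-identityʳ _)))
countSplits-anyHeight n splits -[1+ k ] = sym (begin
  𝒩from -[1+ k ] n + conv (ℳfrom -[1+ k ]) 𝒱 n + + 1 * 𝒱 n
    ≡⟨ cong₂ (λ a b → a + b + + 1 * 𝒱 n) (𝒩from-negative k n)
             (trans (conv-congˡ 𝒱 n (ℳfrom-negative k)) (conv-zeroˡ 𝒱 n)) ⟩
  + 0 + + 0 + + 1 * 𝒱 n  ≡⟨ trans (ℤ.+-identityˡ _) (ℤ.*-identityˡ (𝒱 n)) ⟩
  𝒱 n                    ∎)
  where open ≡-Reasoning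

countSplits : ∀ n j → CountSplits (+ j) n
countSplits zero    j = sym (ℤ.+-identityʳ _)
countSplits (suc n) j = begin
  𝒱 (suc n)
    ≡⟨ sumPaths-suc n (λ _ → + 1) ⟩
  sumSteps (λ _ → 𝒱 n)
    ≡⟨ sumSteps-cong (λ s → countSplits-anyHeight n (countSplits n) (+ j + Δ s)) ⟩
  sumSteps (λ s → stays s + returns s + exits s)
    ≡⟨ sumSteps-+₃ stays returns exits ⟩
  sumSteps stays + sumSteps returns + sumSteps exits
    ≡⟨ cong (_+_ (sumSteps stays + sumSteps returns)) (sumSteps-exits j (λ _ → 𝒱 n)) ⟩
  sumSteps stays + sumSteps returns + ℳfrom (+ j) 0 * 𝒱 n
    ≡⟨ rearrange (sumSteps stays) (sumSteps returns) (ℳfrom (+ j) 0 * 𝒱 n) ⟩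
  sumSteps stays + (ℳfrom (+ j) 0 * 𝒱 n + sumSteps returns)
    ≡⟨ sym (cong₂ _+_ (sumPaths-suc n _) (conv-suc (ℳfrom (+ j)) (λ s → ℳfrom (+ j + Δ s)) 𝒱 n (ℳfrom-suc j))) ⟩
  𝒩from (+ j) (suc n) + conv (ℳfrom (+ j)) 𝒱 (suc n)
    ∎
  where
  open ≡-Reasoning
  stays returns exits : Step → ℤ
  stays s   = 𝒩from (+ j + Δ s) n
  returns s = conv (ℳfrom (+ j + Δ s)) 𝒱 n
  exits s   = 𝟙negative (+ j + Δ s) * 𝒱 n
  rearrange : ∀ a b c → a + b + c ≡ a + (c + b)
  rearrange = solve-∀

-- The same decomposition for a path from height j + 1, weighted by W, which adds the vertex weight α
-- of each height it passes and has an arbitrary terminal value. The ℳ-prefix contributes only its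
-- vertex weights, which P records.
module FirstPassage
  (α : ℕ → ℤ)
  (W P : ℤ → ∀ {n} → Vec Step n → ℤ)
  (W-step : ∀ j {n} s (p : Vec Step n) → W (+ suc j) (s ∷ p) ≡ α (suc j) + W (+ suc j + Δ s) p)
  (P-step : ∀ j {n} s (p : Vec Step n) → P (+ suc j) (s ∷ p) ≡ α (suc j) + P (+ suc j + Δ s) p)
  (P-nil : P (+ 1) [] ≡ α 1)
  where

  weightSum : ℤ → ℕ → ℤ
  weightSum h n = sumPaths n (W h)

  𝒩weight ℳweight : ℤ → ℤ → ℕ → ℤ
  𝒩weight h h′ n = sumPaths n (λ p → when (isNFrom h p) (W h′ p))
  ℳweight h h′ n = sumPaths n (λ p → when (isMFrom h p) (P h′ p))

  WeightSplits : ℤ → ℤ → ℕ → Set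
  WeightSplits h h′ n =
    weightSum h′ n ≡ 𝒩weight h h′ n + conv (ℳweight h h′) 𝒱 n + conv (ℳfrom h) (weightSum (+ 0)) n

  weightSum-suc : ∀ j n → weightSum (+ suc j) (suc n) ≡ sumSteps (λ s → α (suc j) * 𝒱 n + weightSum (+ suc j + Δ s) n)
  weightSum-suc j n = trans (sumPaths-suc n _) (sumSteps-cong (λ s →
    trans (sumPaths-cong n (W-step j s)) (sumPaths-const-+ n (α (suc j)) (W (+ suc j + Δ s)))))

  𝒩weight-suc : ∀ j n → 𝒩weight (+ j) (+ suc j) (suc n)
                ≡ sumSteps (λ s → α (suc j) * 𝒩from (+ j + Δ s) n + 𝒩weight (+ j + Δ s) (+ suc j + Δ s) n)
  𝒩weight-suc j n = trans (sumPaths-suc n _) (sumSteps-cong (λ s →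
    trans (sumPaths-cong n (λ p → cong (when (isNFrom (+ j + Δ s) p)) (W-step j s p)))
          (sumPaths-when-+ n (isNFrom (+ j + Δ s)) (α (suc j)) (W (+ suc j + Δ s)))))

  ℳweight-suc : ∀ j n → ℳweight (+ j) (+ suc j) (suc n)
                ≡ sumSteps (λ s → α (suc j) * ℳfrom (+ j + Δ s) n + ℳweight (+ j + Δ s) (+ suc j + Δ s) n)
  ℳweight-suc j n = trans (sumPaths-suc n _) (sumSteps-cong (λ s →
    trans (sumPaths-cong n (λ p → cong (when (isMFrom (+ j + Δ s) p)) (P-step j s p)))
          (sumPaths-when-+ n (isMFrom (+ j + Δ s)) (α (suc j)) (P (+ suc j + Δ s)))))

  module _ (n : ℕ) where

    stays returns continues : ℕ → Step → ℤ
    stays j s     = α (suc j) * 𝒩from (+ j + Δ s) n + 𝒩weight (+ j + Δ s) (+ suc j + Δ s) n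
    returns j s   = α (suc j) * conv (ℳfrom (+ j + Δ s)) 𝒱 n + conv (ℳweight (+ j + Δ s) (+ suc j + Δ s)) 𝒱 n
    continues j s = conv (ℳfrom (+ j + Δ s)) (weightSum (+ 0)) n

    Split : ℕ → Step → Set
    Split j s = α (suc j) * 𝒱 n + weightSum (+ suc j + Δ s) n
                ≡ stays j s + returns j s + continues j s
                  + 𝟙negative (+ j + Δ s) * (α (suc j) * 𝒱 n + weightSum (+ suc j + Δ s) n)

    split-nonneg : ∀ a m h′ → CountSplits (+ m) n → WeightSplits (+ m) h′ n →
                   a * 𝒱 n + weightSum h′ n
                   ≡ (a * 𝒩from (+ m) n + 𝒩weight (+ m) h′ n)
                     + (a * conv (ℳfrom (+ m)) 𝒱 n + conv (ℳweight (+ m) h′) 𝒱 n)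
                     + conv (ℳfrom (+ m)) (weightSum (+ 0)) n
                     + + 0 * (a * 𝒱 n + weightSum h′ n)
    split-nonneg a m h′ count weight = trans (cong₂ (λ v t → a * v + t) count weight)
      (distribute a (𝒩from (+ m) n) (conv (ℳfrom (+ m)) 𝒱 n) (𝒩weight (+ m) h′ n) (conv (ℳweight (+ m) h′) 𝒱 n)
                  (conv (ℳfrom (+ m)) (weightSum (+ 0)) n) (a * 𝒱 n + weightSum h′ n))
      where
      distribute : ∀ a s r sw rw c l → a * (s + r) + (sw + rw + c) ≡ (a * s + sw) + (a * r + rw) + c + + 0 * l
      distribute = solve-∀

    𝒩weight-negative : ∀ k h′ → 𝒩weight -[1+ k ] h′ n ≡ + 0
    𝒩weight-negative k h′ = trans (sumPaths-cong n (λ p → cong (λ b → when b (W h′ p)) (isNFrom-negative k p)))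
                                  (sumPaths-zero n)

    ℳweight-negative : ∀ k h′ → conv (ℳweight -[1+ k ] h′) 𝒱 n ≡ + 0
    ℳweight-negative k h′ = trans (conv-congˡ 𝒱 n (λ m → trans (sumPaths-cong m (λ p →
      cong (λ b → when (b ∧ endsAtZeroFrom -[1+ k ] p) (P h′ p)) (isNFrom-negative k p))) (sumPaths-zero m)))
      (conv-zeroˡ 𝒱 n)

    returns-negative : ∀ k g → conv (ℳfrom -[1+ k ]) g n ≡ + 0
    returns-negative k g = trans (conv-congˡ g n (ℳfrom-negative k)) (conv-zeroˡ g n)

    split-negative : ∀ a k h′ →
                     a * 𝒱 n + weightSum h′ n
                     ≡ (a * 𝒩from -[1+ k ] n + 𝒩weight -[1+ k ] h′ n)
                       + (a * conv (ℳfrom -[1+ k ]) 𝒱 n + conv (ℳweight -[1+ k ] h′) 𝒱 n)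
                       + conv (ℳfrom -[1+ k ]) (weightSum (+ 0)) n
                       + + 1 * (a * 𝒱 n + weightSum h′ n)
    split-negative a k h′
      rewrite 𝒩from-negative k n | 𝒩weight-negative k h′ | returns-negative k 𝒱 | ℳweight-negative k h′
            | returns-negative k (weightSum (+ 0))
      = sym (only-last a (a * 𝒱 n + weightSum h′ n))
      where
      only-last : ∀ a l → (a * + 0 + + 0) + (a * + 0 + + 0) + + 0 + + 1 * l ≡ l
      only-last = solve-∀

    split : (∀ m → WeightSplits (+ m) (+ suc m) n) → ∀ j s → Split j s
    split weight j       U  = split-nonneg (α (suc j)) (j ℕ.+ 1) (+ suc j + Δ U)  (countSplits n _) (weight _)
    split weight j       O₁ = split-nonneg (α (suc j)) (j ℕ.+ 0) (+ suc j + Δ O₁) (countSplits n _) (weight _)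
    split weight j       O₂ = split-nonneg (α (suc j)) (j ℕ.+ 0) (+ suc j + Δ O₂) (countSplits n _) (weight _)
    split weight zero    D  = split-negative (α 1) 0 (+ 0)
    split weight (suc k) D  = split-nonneg (α (suc (suc k))) k (+ suc k) (countSplits n k) (weight k)

    exits-weight : ∀ j → ℳfrom (+ j) 0 * (α (suc j) * 𝒱 n + weightSum (+ j) n)
                         ≡ ℳweight (+ j) (+ suc j) 0 * 𝒱 n + ℳfrom (+ j) 0 * weightSum (+ 0) n
    exits-weight zero = trans (expand (α 1) (𝒱 n) (weightSum (+ 0) n))
      (cong (λ a → a * 𝒱 n + + 1 * weightSum (+ 0) n) (sym (trans (ℤ.+-identityʳ _) P-nil)))
      where
      expand : ∀ a v t → + 1 * (a * v + t) ≡ a * v + + 1 * t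
      expand = solve-∀
    exits-weight (suc j) = vanish (α (suc (suc j))) (𝒱 n) (weightSum (+ suc j) n) (weightSum (+ 0) n)
      where
      vanish : ∀ a v t t₀ → + 0 * (a * v + t) ≡ (+ 0 + + 0) * v + + 0 * t₀
      vanish = solve-∀

  weightSplits : ∀ n j → WeightSplits (+ j) (+ suc j) n
  weightSplits zero    j = sym (trans (ℤ.+-identityʳ _) (ℤ.+-identityʳ _))
  weightSplits (suc n) j = begin
    weightSum (+ suc j) (suc n)
      ≡⟨ weightSum-suc j n ⟩
    sumSteps (λ s → α (suc j) * 𝒱 n + weightSum (+ suc j + Δ s) n)
      ≡⟨ sumSteps-cong (split n (weightSplits n) j) ⟩
    sumSteps (λ s → S s + R s + C s + E s)
      ≡⟨ trans (sumSteps-+ (λ s → S s + R s + C s) E) (cong (_+ sumSteps E) (sumSteps-+₃ S R C)) ⟩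
    sumSteps S + sumSteps R + sumSteps C + sumSteps E
      ≡⟨ cong (_+_ (sumSteps S + sumSteps R + sumSteps C))
           (trans (sumSteps-exits j (λ s → α (suc j) * 𝒱 n + weightSum (+ suc j + Δ s) n)) (exits-weight n j)) ⟩
    sumSteps S + sumSteps R + sumSteps C + (r₀ * 𝒱 n + m₀ * weightSum (+ 0) n)
      ≡⟨ rearrange (sumSteps S) (sumSteps R) (sumSteps C) (r₀ * 𝒱 n) (m₀ * weightSum (+ 0) n) ⟩
    sumSteps S + (r₀ * 𝒱 n + sumSteps R) + (m₀ * weightSum (+ 0) n + sumSteps C)
      ≡⟨ sym (cong₂ _+_ (cong₂ _+_ (𝒩weight-suc j n) returns-conv) continues-conv) ⟩
    𝒩weight (+ j) (+ suc j) (suc n) + conv (ℳweight (+ j) (+ suc j)) 𝒱 (suc n)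
      + conv (ℳfrom (+ j)) (weightSum (+ 0)) (suc n) ∎
    where
    open ≡-Reasoning
    S R C E : Step → ℤ
    S = stays n j
    R = returns n j
    C = continues n j
    E s = 𝟙negative (+ j + Δ s) * (α (suc j) * 𝒱 n + weightSum (+ suc j + Δ s) n)
    r₀ m₀ : ℤ
    r₀ = ℳweight (+ j) (+ suc j) 0
    m₀ = ℳfrom (+ j) 0
    rearrange : ∀ s r c w z → s + r + c + (w + z) ≡ s + (w + r) + (z + c)
    rearrange = solve-∀
    stepwise : ℤ → ℤ → ℕ → ℤ
    stepwise h h′ k = α (suc j) * ℳfrom h k + ℳweight h h′ k
    returns-conv : conv (ℳweight (+ j) (+ suc j)) 𝒱 (suc n) ≡ r₀ * 𝒱 n + sumSteps R
    returns-conv = trans (conv-suc (ℳweight (+ j) (+ suc j)) (λ s → stepwise (+ j + Δ s) (+ suc j + Δ s)) 𝒱 n (ℳweight-suc j))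
      (cong (_+_ (r₀ * 𝒱 n)) (sumSteps-cong (λ s →
        trans (conv-+ˡ (λ k → α (suc j) * ℳfrom (+ j + Δ s) k) (ℳweight (+ j + Δ s) (+ suc j + Δ s)) 𝒱 n)
              (cong (_+ conv (ℳweight (+ j + Δ s) (+ suc j + Δ s)) 𝒱 n) (conv-*ˡ (α (suc j)) (ℳfrom (+ j + Δ s)) 𝒱 n)))))
    continues-conv : conv (ℳfrom (+ j)) (weightSum (+ 0)) (suc n) ≡ m₀ * weightSum (+ 0) n + sumSteps C
    continues-conv = conv-suc (ℳfrom (+ j)) (λ s → ℳfrom (+ j + Δ s)) (weightSum (+ 0)) n (ℳfrom-suc j)

-- The functional equation

module DbarSplit = FirstPassage +_ (λ h p → + dbarFrom h p) (λ h p → + dbarFrom h p)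
                                (λ j s p → refl) (λ j s p → refl) refl

dbarFrom-mirror : ∀ h {n} (p : Vec Step n) → dbarFrom (ℤ.- h) (mirror p) ≡ dbarFrom h p
dbarFrom-mirror h []      = cong (ℕ._+ 0) (ℤ.∣-i∣≡∣i∣ h)
dbarFrom-mirror h (s ∷ p) = cong₂ ℕ._+_ (ℤ.∣-i∣≡∣i∣ h)
  (trans (cong (λ h′ → dbarFrom h′ (mirror p)) (mirror-next-height h s)) (dbarFrom-mirror (h + Δ s) p))

dbarFrom-lift-step : ∀ j {d d′ n} → d′ ≡ d ℕ.+ suc n → suc j ℕ.+ d′ ≡ (j ℕ.+ d) ℕ.+ suc (suc n)
dbarFrom-lift-step j {d} {n = n} refl = rearrange j d n
  where
  rearrange : ∀ j d n → suc j ℕ.+ (d ℕ.+ suc n) ≡ (j ℕ.+ d) ℕ.+ suc (suc n)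
  rearrange = ℕ-Solver.solve-∀

-- All heights of such a path are ≥ 0, so lifting it adds one to each of the n + 1 terms |rᵢ|.
dbarFrom-lift : ∀ j {n} (p : Vec Step n) → isNFrom (+ j) p ≡ true →
                dbarFrom (+ suc j) p ≡ dbarFrom (+ j) p ℕ.+ suc n
dbarFrom-lift j []                ok = shift-last j
  where
  shift-last : ∀ j → suc j ℕ.+ 0 ≡ (j ℕ.+ 0) ℕ.+ 1
  shift-last = ℕ-Solver.solve-∀
dbarFrom-lift j       {suc n} (U  ∷ p) ok = dbarFrom-lift-step j (dbarFrom-lift (j ℕ.+ 1) p ok)
dbarFrom-lift j       {suc n} (O₁ ∷ p) ok = dbarFrom-lift-step j (dbarFrom-lift (j ℕ.+ 0) p ok)
dbarFrom-lift j       {suc n} (O₂ ∷ p) ok = dbarFrom-lift-step j (dbarFrom-lift (j ℕ.+ 0) p ok)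
dbarFrom-lift (suc j) {suc n} (D  ∷ p) ok = dbarFrom-lift-step (suc j) (dbarFrom-lift j p ok)
dbarFrom-lift zero    {suc n} (D  ∷ p) ok with () ← trans (sym ok) (isNFrom-negative 0 p)

when-lift : ∀ {n} (p : Vec Step n) c →
            when (isN p ∧ c) (+ dbarFrom (+ 1) p) ≡ when (isN p ∧ c) (+ dbar p) + + suc n * 𝟙 (isN p ∧ c)
when-lift {n} p c with isN p in ok | c
... | false | _     = sym (trans (ℤ.+-identityˡ _) (ℤ.*-zeroʳ (+ suc n)))
... | true  | false = sym (trans (ℤ.+-identityˡ _) (ℤ.*-zeroʳ (+ suc n)))
... | true  | true  = trans (cong +_ (dbarFrom-lift 0 p ok))
                        (trans (ℤ.pos-+ (dbar p) (suc n)) (cong (_+_ (+ dbar p)) (sym (ℤ.*-identityʳ (+ suc n)))))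

sumPaths-lift : ∀ n (c : Vec Step n → Bool) →
                sumPaths n (λ p → when (isN p ∧ c p) (+ dbarFrom (+ 1) p))
                ≡ sumPaths n (λ p → when (isN p ∧ c p) (+ dbar p)) + + suc n * sumPaths n (λ p → 𝟙 (isN p ∧ c p))
sumPaths-lift n c = trans (sumPaths-cong n (λ p → when-lift p (c p)))
  (trans (sumPaths-+ n _ _) (cong (_+_ (sumPaths n (λ p → when (isN p ∧ c p) (+ dbar p))))
    (sumPaths-*ˡ n (+ suc n) (λ p → 𝟙 (isN p ∧ c p)))))

open DbarSplit using () renaming (weightSum to dbarSum; 𝒩weight to 𝒩dbar; ℳweight to ℳdbar)

𝒩dbar-lifted : ∀ n → 𝒩dbar (+ 0) (+ 1) n ≡ 𝐍 n + + suc n * 𝒩 n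
𝒩dbar-lifted n = begin
  𝒩dbar (+ 0) (+ 1) n
    ≡⟨ sumPaths-cong n (λ p → cong (λ b → when b (+ dbarFrom (+ 1) p)) (sym (∧-identityʳ (isN p)))) ⟩
  sumPaths n (λ p → when (isN p ∧ true) (+ dbarFrom (+ 1) p))
    ≡⟨ sumPaths-lift n (λ _ → true) ⟩
  sumPaths n (λ p → when (isN p ∧ true) (+ dbar p)) + + suc n * sumPaths n (λ p → 𝟙 (isN p ∧ true))
    ≡⟨ cong₂ (λ d c → d + + suc n * c)
         (sumPaths-cong n (λ p → cong (λ b → when b (+ dbar p)) (∧-identityʳ (isN p))))
         (sumPaths-cong n (λ p → cong 𝟙 (∧-identityʳ (isN p)))) ⟩
  𝐍 n + + suc n * 𝒩 n ∎
  where open ≡-Reasoning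

ℳdbar-lifted : ∀ n → ℳdbar (+ 0) (+ 1) n ≡ 𝐌₁ n + + suc n * ℳ₁ n
ℳdbar-lifted n = sumPaths-lift n endsOnAxis

dbarSum-mirror : ∀ n → dbarSum -[1+ 0 ] n ≡ dbarSum (+ 1) n
dbarSum-mirror n = trans (sym (sumPaths-mirror n (λ p → + dbarFrom -[1+ 0 ] p)))
                         (sumPaths-cong n (λ p → cong +_ (dbarFrom-mirror (+ 1) p)))

𝐕-suc : ∀ n → 𝐕 (suc n) ≡ + 2 * dbarSum (+ 1) n + + 2 * 𝐕 n
𝐕-suc n = trans (sumPaths-suc n (λ p → + dbar p))
  (trans (cong (λ w → dbarSum (+ 1) n + (w + (𝐕 n + (𝐕 n + + 0)))) (dbarSum-mirror n))
         (twice (dbarSum (+ 1) n) (𝐕 n)))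
  where
  twice : ∀ w v → w + (w + (v + (v + + 0))) ≡ + 2 * w + + 2 * v
  twice = solve-∀

dbarSum-lifted : ∀ n → dbarSum (+ 1) n
                       ≡ 𝐍 n + + suc n * 𝒩 n + (X (𝐌₁ ⊛ 𝒱) n + X (𝒱 ⊛ ∂ (X ℳ₁)) n) + X (ℳ₁ ⊛ 𝐕) n
dbarSum-lifted n = begin
  dbarSum (+ 1) n
    ≡⟨ DbarSplit.weightSplits n 0 ⟩
  𝒩dbar (+ 0) (+ 1) n + conv (ℳdbar (+ 0) (+ 1)) 𝒱 n + conv ℳ₁ 𝐕 n
    ≡⟨ cong₂ (λ a b → a + b + conv ℳ₁ 𝐕 n) (𝒩dbar-lifted n)
         (trans (conv-congˡ 𝒱 n ℳdbar-lifted) (conv-+ˡ 𝐌₁ (λ k → + suc k * ℳ₁ k) 𝒱 n)) ⟩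
  𝐍 n + + suc n * 𝒩 n + (conv 𝐌₁ 𝒱 n + conv (∂ (X ℳ₁)) 𝒱 n) + conv ℳ₁ 𝐕 n
    ≡⟨ cong₂ (λ a b → 𝐍 n + + suc n * 𝒩 n + a + b)
         (cong₂ _+_ (sym (X-⊛≡conv 𝐌₁ 𝒱 n))
                    (trans (conv-comm (∂ (X ℳ₁)) 𝒱 n) (sym (X-⊛≡conv 𝒱 (∂ (X ℳ₁)) n))))
         (sym (X-⊛≡conv ℳ₁ 𝐕 n)) ⟩
  𝐍 n + + suc n * 𝒩 n + (X (𝐌₁ ⊛ 𝒱) n + X (𝒱 ⊛ ∂ (X ℳ₁)) n) + X (ℳ₁ ⊛ 𝐕) n ∎
  where open ≡-Reasoning

functionalEquation : 𝐕 ≐ (+ 2) · X 𝐕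
                         ⊕ (+ 2) · X (X (𝐌₁ ⊛ 𝒱))
                         ⊕ (+ 2) · X (X (ℳ₁ ⊛ 𝐕))
                         ⊕ (+ 2) · X (X (𝒱 ⊛ ∂ (X ℳ₁)))
                         ⊕ (+ 2) · X 𝐍
                         ⊕ (+ 2) · X (∂ (X 𝒩))
functionalEquation zero    = refl
functionalEquation (suc n) =
  trans (𝐕-suc n) (trans (cong (λ w → + 2 * w + + 2 * 𝐕 n) (dbarSum-lifted n))
    (distribute (𝐍 n) (+ suc n * 𝒩 n) (X (𝐌₁ ⊛ 𝒱) n) (X (𝒱 ⊛ ∂ (X ℳ₁)) n) (X (ℳ₁ ⊛ 𝐕) n) (𝐕 n)))
  where
  distribute : ∀ N sN M K MV V → + 2 * (N + sN + (M + K) + MV) + + 2 * V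
               ≡ + 2 * V + + 2 * M + + 2 * MV + + 2 * K + + 2 * N + + 2 * sN
  distribute = solve-∀

-- The closed form

endHeightSum bridgesFrom : ℤ → ℕ → ℤ
endHeightSum h n = sumPaths n (λ p → + ∣ finalHeightFrom h p ∣)
bridgesFrom  h n = sumPaths n (λ p → 𝟙 (endsAtZeroFrom h p))

bridges : Series
bridges = bridgesFrom (+ 0)

-- |h + 1| + |h - 1| + 2|h| = 4|h| + 2·[h = 0]
endHeightSum-base : ∀ h → endHeightSum h 1 ≡ + 4 * endHeightSum h 0 + + 2 * bridgesFrom h 0
endHeightSum-base (+ zero)    = refl
endHeightSum-base (+ suc k)   = cong +_ (three-neighbours k)
  where
  three-neighbours : ∀ k → (suc k ℕ.+ 1) ℕ.+ (k ℕ.+ ((suc k ℕ.+ 0) ℕ.+ ((suc k ℕ.+ 0) ℕ.+ 0)))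
                           ≡ suc (k ℕ.+ 0 ℕ.+ 3 ℕ.* suc (k ℕ.+ 0)) ℕ.+ 0
  three-neighbours = ℕ-Solver.solve-∀
endHeightSum-base -[1+ zero ]  = refl
endHeightSum-base -[1+ suc k ] = cong +_ (three-neighbours k)
  where
  three-neighbours : ∀ k → suc k ℕ.+ (suc (suc (suc k ℕ.+ 0)) ℕ.+ (suc (suc k) ℕ.+ (suc (suc k) ℕ.+ 0)))
                           ≡ suc (suc (k ℕ.+ 0 ℕ.+ 3 ℕ.* suc (suc (k ℕ.+ 0)))) ℕ.+ 0
  three-neighbours = ℕ-Solver.solve-∀

endHeightSum-suc : ∀ n h → endHeightSum h (suc n) ≡ + 4 * endHeightSum h n + + 2 * bridgesFrom h n
endHeightSum-suc zero    h = endHeightSum-base h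
endHeightSum-suc (suc n) h = begin
  endHeightSum h (suc (suc n))
    ≡⟨ sumPaths-suc (suc n) _ ⟩
  sumSteps (λ s → endHeightSum (h + Δ s) (suc n))
    ≡⟨ sumSteps-cong (λ s → endHeightSum-suc n (h + Δ s)) ⟩
  sumSteps (λ s → + 4 * E s + + 2 * B s)
    ≡⟨ trans (sumSteps-+ (λ s → + 4 * E s) (λ s → + 2 * B s))
             (cong₂ _+_ (sumℤ-*ˡ (+ 4) E allSteps) (sumℤ-*ˡ (+ 2) B allSteps)) ⟩
  + 4 * sumSteps E + + 2 * sumSteps B
    ≡⟨ sym (cong₂ (λ e b → + 4 * e + + 2 * b) (sumPaths-suc n _) (sumPaths-suc n _)) ⟩
  + 4 * endHeightSum h (suc n) + + 2 * bridgesFrom h (suc n) ∎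
  where
  open ≡-Reasoning
  E B : Step → ℤ
  E s = endHeightSum (h + Δ s) n
  B s = bridgesFrom (h + Δ s) n

dbarSum-zero : ∀ h → dbarSum h 0 ≡ endHeightSum h 0
dbarSum-zero h = cong (λ d → + d + + 0) (ℕ.+-identityʳ ∣ h ∣)

dbarSum-suc : ∀ h n → dbarSum h (suc n) ≡ sumSteps (λ s → + ∣ h ∣ * 𝒱 n + dbarSum (h + Δ s) n)
dbarSum-suc h n = trans (sumPaths-suc n _)
  (sumSteps-cong (λ s → sumPaths-const-+ n (+ ∣ h ∣) (λ p → + dbarFrom (h + Δ s) p)))

-- The last height of a path adds |r_{n+1}| to the d̄ of its prefix, which has four extensions.
dbarSum-last : ∀ n h → dbarSum h (suc n) ≡ + 4 * dbarSum h n + endHeightSum h (suc n)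
dbarSum-last zero h = begin
  dbarSum h 1
    ≡⟨ dbarSum-suc h 0 ⟩
  sumSteps (λ s → + ∣ h ∣ * + 1 + dbarSum (h + Δ s) 0)
    ≡⟨ sumSteps-cong (λ s → cong (_+_ (+ ∣ h ∣ * + 1)) (dbarSum-zero (h + Δ s))) ⟩
  sumSteps (λ s → + ∣ h ∣ * + 1 + E s)
    ≡⟨ collect (+ ∣ h ∣) (E U) (E D) (E O₁) (E O₂) ⟩
  + 4 * (+ ∣ h ∣ + + 0) + sumSteps E
    ≡⟨ cong₂ (λ w e → + 4 * w + e) (sym (dbarSum-zero h)) (sym (sumPaths-suc 0 (λ p → + ∣ finalHeightFrom h p ∣))) ⟩
  + 4 * dbarSum h 0 + endHeightSum h 1
    ∎
  where
  open ≡-Reasoning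
  E : Step → ℤ
  E s = endHeightSum (h + Δ s) 0
  collect : ∀ c u d o o′ → (c * + 1 + u) + ((c * + 1 + d) + ((c * + 1 + o) + ((c * + 1 + o′) + + 0)))
                           ≡ + 4 * (c + + 0) + (u + (d + (o + (o′ + + 0))))
  collect = solve-∀
dbarSum-last (suc n) h = begin
  dbarSum h (suc (suc n))
    ≡⟨ dbarSum-suc h (suc n) ⟩
  sumSteps (λ s → c * 𝒱 (suc n) + dbarSum (h + Δ s) (suc n))
    ≡⟨ sumSteps-cong (λ s → cong₂ (λ v w → c * v + w) (𝒱-suc n) (dbarSum-last n (h + Δ s))) ⟩
  sumSteps (λ s → c * (+ 4 * 𝒱 n) + (+ 4 * T s + E s))
    ≡⟨ collect c (𝒱 n) (T U) (T D) (T O₁) (T O₂) (E U) (E D) (E O₁) (E O₂) ⟩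
  + 4 * sumSteps (λ s → c * 𝒱 n + T s) + sumSteps E
    ≡⟨ sym (cong₂ (λ w e → + 4 * w + e) (dbarSum-suc h n) (sumPaths-suc (suc n) _)) ⟩
  + 4 * dbarSum h (suc n) + endHeightSum h (suc (suc n)) ∎
  where
  open ≡-Reasoning
  c = + ∣ h ∣
  T E : Step → ℤ
  T s = dbarSum (h + Δ s) n
  E s = endHeightSum (h + Δ s) (suc n)
  collect : ∀ c v a b d e f g h i →
    (c * (+ 4 * v) + (+ 4 * a + f)) + ((c * (+ 4 * v) + (+ 4 * b + g))
      + ((c * (+ 4 * v) + (+ 4 * d + h)) + ((c * (+ 4 * v) + (+ 4 * e + i)) + + 0)))
    ≡ + 4 * ((c * v + a) + ((c * v + b) + ((c * v + d) + ((c * v + e) + + 0)))) + (f + (g + (h + (i + + 0))))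
  collect = solve-∀

finalHeightFrom-mirror : ∀ h {n} (p : Vec Step n) →
                         finalHeightFrom (ℤ.- h) (mirror p) ≡ ℤ.- finalHeightFrom h p
finalHeightFrom-mirror h []      = refl
finalHeightFrom-mirror h (s ∷ p) = trans
  (cong (λ h′ → finalHeightFrom h′ (mirror p)) (mirror-next-height h s))
  (finalHeightFrom-mirror (h + Δ s) p)

isZero-neg : ∀ i → isZero (ℤ.- i) ≡ isZero i
isZero-neg (+ zero)  = refl
isZero-neg (+ suc k) = refl
isZero-neg -[1+ k ]  = refl

bridgesFrom-mirror : ∀ n → bridgesFrom -[1+ 0 ] n ≡ bridgesFrom (+ 1) n
bridgesFrom-mirror n = trans (sym (sumPaths-mirror n (λ p → 𝟙 (endsAtZeroFrom -[1+ 0 ] p))))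
  (sumPaths-cong n (λ p → cong 𝟙 (trans (cong isZero (finalHeightFrom-mirror (+ 1) p))
                                         (isZero-neg (finalHeightFrom (+ 1) p)))))

finalHeightFrom-lift : ∀ j {n} (p : Vec Step n) → isNFrom (+ j) p ≡ true →
                       ∃ λ k → finalHeightFrom (+ suc j) p ≡ + suc k
finalHeightFrom-lift j       []       ok = j , refl
finalHeightFrom-lift j       (U  ∷ p) ok = finalHeightFrom-lift (j ℕ.+ 1) p ok
finalHeightFrom-lift j       (O₁ ∷ p) ok = finalHeightFrom-lift (j ℕ.+ 0) p ok
finalHeightFrom-lift j       (O₂ ∷ p) ok = finalHeightFrom-lift (j ℕ.+ 0) p ok
finalHeightFrom-lift (suc j) (D  ∷ p) ok = finalHeightFrom-lift j p ok
finalHeightFrom-lift zero    (D  ∷ p) ok with () ← trans (sym ok) (isNFrom-negative 0 p)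

lifted-not-endsAtZero : ∀ {n} (p : Vec Step n) → isN p ≡ true → endsAtZeroFrom (+ 1) p ≡ false
lifted-not-endsAtZero p ok with finalHeightFrom-lift 0 p ok
... | k , fin≡ rewrite fin≡ = refl

when-false : ∀ b x → (b ≡ true → x ≡ + 0) → when b x ≡ + 0
when-false true  x x≡0 = x≡0 refl
when-false false x x≡0 = refl

module ReturnSplit
  (W : ℤ → ∀ {n} → Vec Step n → ℤ)
  (W-step : ∀ j {n} s (p : Vec Step n) → W (+ suc j) (s ∷ p) ≡ W (+ suc j + Δ s) p)
  (W-lifted : ∀ {n} (p : Vec Step n) → isN p ≡ true → W (+ 1) p ≡ + 0)
  where

  open FirstPassage (λ _ → + 0) W (λ _ _ → + 0)
                    (λ j s p → trans (W-step j s p) (sym (ℤ.+-identityˡ _))) (λ j s p → refl) refl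

  weightSum-one : ∀ n → weightSum (+ 1) n ≡ conv ℳ₁ (weightSum (+ 0)) n
  weightSum-one n = begin
    weightSum (+ 1) n
      ≡⟨ weightSplits n 0 ⟩
    𝒩weight (+ 0) (+ 1) n + conv (ℳweight (+ 0) (+ 1)) 𝒱 n + conv ℳ₁ (weightSum (+ 0)) n
      ≡⟨ cong₂ (λ a b → a + b + conv ℳ₁ (weightSum (+ 0)) n)
           (trans (sumPaths-cong n (λ p → when-false (isN p) (W (+ 1) p) (W-lifted p))) (sumPaths-zero n))
           (trans (conv-congˡ 𝒱 n (λ k → trans (sumPaths-cong k (λ p → when-false (isM p) (+ 0) (λ _ → refl)))
                                                (sumPaths-zero k)))
                  (conv-zeroˡ 𝒱 n)) ⟩
    + 0 + + 0 + conv ℳ₁ (weightSum (+ 0)) n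
      ≡⟨ ℤ.+-identityˡ _ ⟩
    conv ℳ₁ (weightSum (+ 0)) n ∎
    where open ≡-Reasoning

module BridgeSplit = ReturnSplit (λ h p → 𝟙 (endsAtZeroFrom h p)) (λ j s p → refl)
                                 (λ p ok → cong 𝟙 (lifted-not-endsAtZero p ok))
module ℳSplit = ReturnSplit (λ h p → 𝟙 (isMFrom h p)) (λ j s p → refl)
                            (λ p ok → trans (cong (λ b → 𝟙 (isNFrom (+ 1) p ∧ b)) (lifted-not-endsAtZero p ok))
                                            (cong 𝟙 (∧-zeroʳ (isNFrom (+ 1) p))))

bridges-suc : ∀ n → bridges (suc n) ≡ + 2 * bridges n + + 2 * conv ℳ₁ bridges n
bridges-suc n = begin
  bridges (suc n)
    ≡⟨ sumPaths-suc n _ ⟩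
  bridgesFrom (+ 1) n + (bridgesFrom -[1+ 0 ] n + (bridges n + (bridges n + + 0)))
    ≡⟨ cong (λ b → bridgesFrom (+ 1) n + (b + (bridges n + (bridges n + + 0)))) (bridgesFrom-mirror n) ⟩
  bridgesFrom (+ 1) n + (bridgesFrom (+ 1) n + (bridges n + (bridges n + + 0)))
    ≡⟨ cong (λ b → b + (b + (bridges n + (bridges n + + 0)))) (BridgeSplit.weightSum-one n) ⟩
  conv ℳ₁ bridges n + (conv ℳ₁ bridges n + (bridges n + (bridges n + + 0)))
    ≡⟨ collect (conv ℳ₁ bridges n) (bridges n) ⟩
  + 2 * bridges n + + 2 * conv ℳ₁ bridges n ∎
  where
  open ≡-Reasoning
  collect : ∀ c g → c + (c + (g + (g + + 0))) ≡ + 2 * g + + 2 * c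
  collect = solve-∀

ℳ₁-suc : ∀ n → ℳ₁ (suc n) ≡ + 2 * ℳ₁ n + conv ℳ₁ ℳ₁ n
ℳ₁-suc n = begin
  ℳ₁ (suc n)
    ≡⟨ sumPaths-suc n _ ⟩
  ℳfrom (+ 1) n + (ℳfrom -[1+ 0 ] n + (ℳ₁ n + (ℳ₁ n + + 0)))
    ≡⟨ cong₂ (λ a b → a + (b + (ℳ₁ n + (ℳ₁ n + + 0)))) (ℳSplit.weightSum-one n) (ℳfrom-negative 0 n) ⟩
  conv ℳ₁ ℳ₁ n + (+ 0 + (ℳ₁ n + (ℳ₁ n + + 0)))
    ≡⟨ collect (conv ℳ₁ ℳ₁ n) (ℳ₁ n) ⟩
  + 2 * ℳ₁ n + conv ℳ₁ ℳ₁ n ∎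
  where
  open ≡-Reasoning
  collect : ∀ c m → c + (+ 0 + (m + (m + + 0))) ≡ + 2 * m + c
  collect = solve-∀

oneMinus4x-⊛ : ∀ f g → f 0 ≡ g 0 → (∀ n → f (suc n) ≡ + 4 * f n + g (suc n)) → oneMinus4x ⊛ f ≐ g
oneMinus4x-⊛ f g f₀ f-suc zero    = trans (⊛≡conv oneMinus4x f 0) (trans (unit (f 0)) f₀)
  where
  unit : ∀ a → + 1 * a + + 0 ≡ a
  unit = solve-∀
oneMinus4x-⊛ f g f₀ f-suc (suc n) = begin
  (oneMinus4x ⊛ f) (suc n)
    ≡⟨ ⊛≡conv oneMinus4x f (suc n) ⟩
  + 1 * f (suc n) + (-[1+ 3 ] * f n + sumBelow _ n)
    ≡⟨ cong (λ t → + 1 * f (suc n) + (-[1+ 3 ] * f n + t)) (sumBelow-zero n) ⟩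
  + 1 * f (suc n) + (-[1+ 3 ] * f n + + 0)
    ≡⟨ cong (λ a → + 1 * a + (-[1+ 3 ] * f n + + 0)) (f-suc n) ⟩
  + 1 * (+ 4 * f n + g (suc n)) + (-[1+ 3 ] * f n + + 0)
    ≡⟨ cancel (f n) (g (suc n)) ⟩
  g (suc n)
    ∎
  where
  open ≡-Reasoning
  cancel : ∀ a b → + 1 * (+ 4 * a + b) + (-[1+ 3 ] * a + + 0) ≡ b
  cancel = solve-∀

·X≐ : ∀ c f → c · X f ≐ const c ⊛ xₛ ⊛ f
·X≐ c f = begin
  c · X f               ≈⟨ ·≐const⊛ c (X f) ⟩
  const c ⊛ X f         ≈⟨ ⊛-cong (≐-refl {const c}) (X≐xₛ⊛ f) ⟩
  const c ⊛ (xₛ ⊛ f)    ≈⟨ ≐-sym {const c ⊛ xₛ ⊛ f} (⊛-assoc (const c) xₛ f) ⟩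
  const c ⊛ xₛ ⊛ f      ∎
  where open ≐-Reasoning

·XX≐ : ∀ c f → c · X (X f) ≐ const c ⊛ xₛ ⊛ xₛ ⊛ f
·XX≐ c f = begin
  c · X (X f)                 ≈⟨ ·X≐ c (X f) ⟩
  const c ⊛ xₛ ⊛ X f          ≈⟨ ⊛-cong (≐-refl {const c ⊛ xₛ}) (X≐xₛ⊛ f) ⟩
  const c ⊛ xₛ ⊛ (xₛ ⊛ f)     ≈⟨ ≐-sym {const c ⊛ xₛ ⊛ xₛ ⊛ f} (⊛-assoc (const c ⊛ xₛ) xₛ f) ⟩
  const c ⊛ xₛ ⊛ xₛ ⊛ f       ∎
  where open ≐-Reasoning

endHeights : Series
endHeights = endHeightSum (+ 0)

oneMinus4x-⊛𝐕 : oneMinus4x ⊛ 𝐕 ≐ endHeights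
oneMinus4x-⊛𝐕 = oneMinus4x-⊛ 𝐕 endHeights (dbarSum-zero (+ 0)) (λ n → dbarSum-last n (+ 0))

oneMinus4x-⊛endHeights : oneMinus4x ⊛ endHeights ≐ const (+ 2) ⊛ xₛ ⊛ bridges
oneMinus4x-⊛endHeights = ≐-trans {oneMinus4x ⊛ endHeights} {(+ 2) · X bridges}
  (oneMinus4x-⊛ endHeights ((+ 2) · X bridges) refl (λ n → endHeightSum-suc n (+ 0)))
  (·X≐ (+ 2) bridges)

bridges-equation : bridges ≐ 1ₛ ⊕ const (+ 2) ⊛ xₛ ⊛ bridges ⊕ const (+ 2) ⊛ xₛ ⊛ xₛ ⊛ (ℳ₁ ⊛ bridges)
bridges-equation = ≐-trans {bridges} coefficients
  (⊕-cong (⊕-cong (≐-refl {1ₛ}) (·X≐ (+ 2) bridges)) (·XX≐ (+ 2) (ℳ₁ ⊛ bridges)))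
  where
  coefficients : bridges ≐ 1ₛ ⊕ (+ 2) · X bridges ⊕ (+ 2) · X (X (ℳ₁ ⊛ bridges))
  coefficients zero    = refl
  coefficients (suc n) = trans (bridges-suc n) (sym (trans
    (cong (_+ + 2 * X (ℳ₁ ⊛ bridges) n) (ℤ.+-identityˡ (+ 2 * bridges n)))
    (cong (λ c → + 2 * bridges n + + 2 * c) (X-⊛≡conv ℳ₁ bridges n))))

ℳ₁-equation : ℳ₁ ≐ 1ₛ ⊕ const (+ 2) ⊛ xₛ ⊛ ℳ₁ ⊕ const (+ 1) ⊛ xₛ ⊛ xₛ ⊛ (ℳ₁ ⊛ ℳ₁)
ℳ₁-equation = ≐-trans {ℳ₁} coefficients
  (⊕-cong (⊕-cong (≐-refl {1ₛ}) (·X≐ (+ 2) ℳ₁)) (·XX≐ (+ 1) (ℳ₁ ⊛ ℳ₁)))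
  where
  coefficients : ℳ₁ ≐ 1ₛ ⊕ (+ 2) · X ℳ₁ ⊕ (+ 1) · X (X (ℳ₁ ⊛ ℳ₁))
  coefficients zero    = refl
  coefficients (suc n) = trans (ℳ₁-suc n) (sym (trans
    (cong (_+ + 1 * X (ℳ₁ ⊛ ℳ₁) n) (ℤ.+-identityˡ (+ 2 * ℳ₁ n)))
    (cong (_+_ (+ 2 * ℳ₁ n)) (trans (ℤ.*-identityˡ (X (ℳ₁ ⊛ ℳ₁) n)) (X-⊛≡conv ℳ₁ ℳ₁ n)))))

oneMinus4x≐ : oneMinus4x ≐ 1ₛ ⊕ neg (const (+ 4) ⊛ xₛ)
oneMinus4x≐ n = cong (λ c → const (+ 1) n + ℤ.- c) (·≐const⊛ (+ 4) xₛ n)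

oneMinus4x²-⊛𝐕 : oneMinus4x ⊛ oneMinus4x ⊛ 𝐕 ≐ const (+ 2) ⊛ xₛ ⊛ bridges
oneMinus4x²-⊛𝐕 = begin
  oneMinus4x ⊛ oneMinus4x ⊛ 𝐕      ≈⟨ ⊛-assoc oneMinus4x oneMinus4x 𝐕 ⟩
  oneMinus4x ⊛ (oneMinus4x ⊛ 𝐕)    ≈⟨ ⊛-cong (≐-refl {oneMinus4x}) oneMinus4x-⊛𝐕 ⟩
  oneMinus4x ⊛ endHeights          ≈⟨ oneMinus4x-⊛endHeights ⟩
  const (+ 2) ⊛ xₛ ⊛ bridges       ∎
  where open ≐-Reasoning

√oneMinus4x : Series
√oneMinus4x = 1ₛ ⊕ neg (const (+ 2) ⊛ xₛ) ⊕ neg (const (+ 2) ⊛ xₛ ⊛ xₛ ⊛ ℳ₁)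

√oneMinus4x-squared : √oneMinus4x ⊛ √oneMinus4x ≐ oneMinus4x
√oneMinus4x-squared = begin
  √oneMinus4x ⊛ √oneMinus4x
    ≈⟨ solve 2 (λ x M → (con (+ 1) :+ :- (con (+ 2) :* x) :+ :- (con (+ 2) :* x :* x :* M))
                        :* (con (+ 1) :+ :- (con (+ 2) :* x) :+ :- (con (+ 2) :* x :* x :* M))
                     := con (+ 1) :+ :- (con (+ 4) :* x)
                        :+ con (+ 4) :* x :* x :* (con (+ 1) :+ con (+ 2) :* x :* M :+ con (+ 1) :* x :* x :* (M :* M) :+ :- M))
               (λ _ → refl) xₛ ℳ₁ ⟩
  1ₛ ⊕ neg (const (+ 4) ⊛ xₛ)
    ⊕ const (+ 4) ⊛ xₛ ⊛ xₛ ⊛ (1ₛ ⊕ const (+ 2) ⊛ xₛ ⊛ ℳ₁ ⊕ const (+ 1) ⊛ xₛ ⊛ xₛ ⊛ (ℳ₁ ⊛ ℳ₁) ⊕ neg ℳ₁)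
    ≈⟨ ⊕-cong (≐-refl {1ₛ ⊕ neg (const (+ 4) ⊛ xₛ)})
              (⊛-cong (≐-refl {const (+ 4) ⊛ xₛ ⊛ xₛ}) (⊕-cong (≐-sym {ℳ₁} ℳ₁-equation) (≐-refl {neg ℳ₁}))) ⟩
  1ₛ ⊕ neg (const (+ 4) ⊛ xₛ) ⊕ const (+ 4) ⊛ xₛ ⊛ xₛ ⊛ (ℳ₁ ⊕ neg ℳ₁)
    ≈⟨ solve 2 (λ x M → con (+ 1) :+ :- (con (+ 4) :* x) :+ con (+ 4) :* x :* x :* (M :+ :- M)
                     := con (+ 1) :+ :- (con (+ 4) :* x))
               (λ _ → refl) xₛ ℳ₁ ⟩
  1ₛ ⊕ neg (const (+ 4) ⊛ xₛ)
    ≈⟨ ≐-sym {oneMinus4x} oneMinus4x≐ ⟩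
  oneMinus4x ∎
  where open ≐-Reasoning

√oneMinus4x-⊛bridges : √oneMinus4x ⊛ bridges ≐ 1ₛ
√oneMinus4x-⊛bridges = begin
  √oneMinus4x ⊛ bridges
    ≈⟨ solve 3 (λ x M G → (con (+ 1) :+ :- (con (+ 2) :* x) :+ :- (con (+ 2) :* x :* x :* M)) :* G
                       := G :+ :- (con (+ 2) :* x :* G) :+ :- (con (+ 2) :* x :* x :* (M :* G)))
               (λ _ → refl) xₛ ℳ₁ bridges ⟩
  bridges ⊕ neg (const (+ 2) ⊛ xₛ ⊛ bridges) ⊕ neg (const (+ 2) ⊛ xₛ ⊛ xₛ ⊛ (ℳ₁ ⊛ bridges))
    ≈⟨ ⊕-cong (⊕-cong bridges-equation (≐-refl {neg (const (+ 2) ⊛ xₛ ⊛ bridges)}))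
              (≐-refl {neg (const (+ 2) ⊛ xₛ ⊛ xₛ ⊛ (ℳ₁ ⊛ bridges))}) ⟩
  1ₛ ⊕ const (+ 2) ⊛ xₛ ⊛ bridges ⊕ const (+ 2) ⊛ xₛ ⊛ xₛ ⊛ (ℳ₁ ⊛ bridges)
    ⊕ neg (const (+ 2) ⊛ xₛ ⊛ bridges) ⊕ neg (const (+ 2) ⊛ xₛ ⊛ xₛ ⊛ (ℳ₁ ⊛ bridges))
    ≈⟨ solve 3 (λ x M G → con (+ 1) :+ con (+ 2) :* x :* G :+ con (+ 2) :* x :* x :* (M :* G)
                          :+ :- (con (+ 2) :* x :* G) :+ :- (con (+ 2) :* x :* x :* (M :* G))
                       := con (+ 1))
               (λ _ → refl) xₛ ℳ₁ bridges ⟩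
  1ₛ ∎
  where open ≐-Reasoning

-- Coefficient n of g ⊛ f is g₀ fₙ plus terms in earlier coefficients of f.
⊛-noZeroDivisor : ∀ f g → f ⊛ g ≐ 0ₛ → g 0 ≢ + 0 → f ≐ 0ₛ
⊛-noZeroDivisor f g fg≐0 g₀≢0 n = trans (<-rec (λ n → f n ≡ + 0) vanishes n) (sym (0ₛ-coeff n))
  where
  vanishes : ∀ n → (∀ {k} → k < n → f k ≡ + 0) → f n ≡ + 0
  vanishes n earlier with ℤ.i*j≡0⇒i≡0∨j≡0 (g 0) {f n} leading
    where
    tail : ∀ n → (∀ {k} → k < n → f k ≡ + 0) → X ((g ∘ suc) ⊛ f) n ≡ + 0
    tail zero    earlier = refl
    tail (suc m) earlier = trans (⊛≡conv (g ∘ suc) f m) (trans (sumBelow-cong (suc m) (λ k _ →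
      trans (cong (g (suc k) *_) (earlier (s≤s (ℕ.m∸n≤m m k)))) (ℤ.*-zeroʳ (g (suc k))))) (sumBelow-zero (suc m)))
    leading : g 0 * f n ≡ + 0
    leading = begin
      g 0 * f n                            ≡⟨ sym (ℤ.+-identityʳ _) ⟩
      g 0 * f n + + 0                      ≡⟨ cong (_+_ (g 0 * f n)) (sym (tail n earlier)) ⟩
      g 0 * f n + X ((g ∘ suc) ⊛ f) n      ≡⟨ sym (⊛-unfoldˡ g f n) ⟩
      (g ⊛ f) n                            ≡⟨ ⊛-comm g f n ⟩
      (f ⊛ g) n                            ≡⟨ trans (fg≐0 n) (0ₛ-coeff n) ⟩
      + 0                                  ∎
      where open ≡-Reasoning
  ... | inj₁ g₀≡0 = ⊥-elim (g₀≢0 g₀≡0)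
  ... | inj₂ fₙ≡0 = fₙ≡0

square-root-unique : ∀ S T → S 0 ≡ + 1 → T 0 ≡ + 1 → S ⊛ S ≐ T ⊛ T → S ≐ T
square-root-unique S T S₀ T₀ S²≐T² n = ℤ.i-j≡0⇒i≡j (S n) (T n)
  (trans (⊛-noZeroDivisor (S ⊕ neg T) (S ⊕ T) difference-of-squares sum-nonzero n) (0ₛ-coeff n))
  where
  difference-of-squares : (S ⊕ neg T) ⊛ (S ⊕ T) ≐ 0ₛ
  difference-of-squares = begin
    (S ⊕ neg T) ⊛ (S ⊕ T)     ≈⟨ solve 2 (λ s t → (s :+ :- t) :* (s :+ t) := s :* s :+ :- (t :* t)) (λ _ → refl) S T ⟩
    S ⊛ S ⊕ neg (T ⊛ T)       ≈⟨ ⊕-cong S²≐T² (≐-refl {neg (T ⊛ T)}) ⟩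
    T ⊛ T ⊕ neg (T ⊛ T)       ≈⟨ solve 1 (λ t → t :+ :- t := con (+ 0)) (λ _ → refl) (T ⊛ T) ⟩
    0ₛ                        ∎
    where open ≐-Reasoning
  sum-nonzero : (S ⊕ T) 0 ≢ + 0
  sum-nonzero S₀+T₀≡0 with trans (sym (cong₂ _+_ S₀ T₀)) S₀+T₀≡0
  ... | ()

module _ (S : Series) (isSqrt : IsSqrt1m4x S) where

  open Σ isSqrt renaming (proj₁ to S₀; proj₂ to S²≐)

  S⊛bridges : S ⊛ bridges ≐ 1ₛ
  S⊛bridges = ≐-trans {S ⊛ bridges} (⊛-cong S≐√ (≐-refl {bridges})) √oneMinus4x-⊛bridges
    where
    S≐√ : S ≐ √oneMinus4x
    S≐√ = square-root-unique S √oneMinus4x S₀ refl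
            (≐-trans {S ⊛ S} S²≐ (≐-sym {√oneMinus4x ⊛ √oneMinus4x} √oneMinus4x-squared))

  S⁵-⊛𝐕 : S ⊛ (S ⊛ S) ⊛ (S ⊛ S) ⊛ 𝐕 ≐ const (+ 2) ⊛ xₛ
  S⁵-⊛𝐕 = begin
    S ⊛ (S ⊛ S) ⊛ (S ⊛ S) ⊛ 𝐕
      ≈⟨ ⊛-cong (⊛-cong (⊛-cong (≐-refl {S}) S²≐) S²≐) (≐-refl {𝐕}) ⟩
    S ⊛ oneMinus4x ⊛ oneMinus4x ⊛ 𝐕
      ≈⟨ solve 3 (λ s o v → s :* o :* o :* v := s :* (o :* o :* v)) (λ _ → refl) S oneMinus4x 𝐕 ⟩
    S ⊛ (oneMinus4x ⊛ oneMinus4x ⊛ 𝐕)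
      ≈⟨ ⊛-cong (≐-refl {S}) oneMinus4x²-⊛𝐕 ⟩
    S ⊛ (const (+ 2) ⊛ xₛ ⊛ bridges)
      ≈⟨ solve 3 (λ s x g → s :* (con (+ 2) :* x :* g) := con (+ 2) :* x :* (s :* g)) (λ _ → refl) S xₛ bridges ⟩
    const (+ 2) ⊛ xₛ ⊛ (S ⊛ bridges)
      ≈⟨ ⊛-cong (≐-refl {const (+ 2) ⊛ xₛ}) S⊛bridges ⟩
    const (+ 2) ⊛ xₛ ⊛ 1ₛ
      ≈⟨ solve 1 (λ x → con (+ 2) :* x :* con (+ 1) := con (+ 2) :* x) (λ _ → refl) xₛ ⟩
    const (+ 2) ⊛ xₛ ∎
    where open ≐-Reasoning

  one+S-cubed : (1ₛ ⊕ S) ⊛ (1ₛ ⊕ S) ⊛ (1ₛ ⊕ S) ≐ const (+ 4) ⊛ (1ₛ ⊕ S ⊕ neg (xₛ ⊛ (const (+ 3) ⊕ S)))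
  one+S-cubed = begin
    (1ₛ ⊕ S) ⊛ (1ₛ ⊕ S) ⊛ (1ₛ ⊕ S)
      ≈⟨ solve 1 (λ s → (con (+ 1) :+ s) :* (con (+ 1) :+ s) :* (con (+ 1) :+ s)
                     := con (+ 1) :+ con (+ 3) :* s :+ (con (+ 3) :+ s) :* (s :* s)) (λ _ → refl) S ⟩
    1ₛ ⊕ const (+ 3) ⊛ S ⊕ (const (+ 3) ⊕ S) ⊛ (S ⊛ S)
      ≈⟨ ⊕-cong (≐-refl {1ₛ ⊕ const (+ 3) ⊛ S}) (⊛-cong (≐-refl {const (+ 3) ⊕ S}) (≐-trans {S ⊛ S} S²≐ oneMinus4x≐)) ⟩
    1ₛ ⊕ const (+ 3) ⊛ S ⊕ (const (+ 3) ⊕ S) ⊛ (1ₛ ⊕ neg (const (+ 4) ⊛ xₛ))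
      ≈⟨ solve 2 (λ s x → con (+ 1) :+ con (+ 3) :* s :+ (con (+ 3) :+ s) :* (con (+ 1) :+ :- (con (+ 4) :* x))
                       := con (+ 4) :* (con (+ 1) :+ s :+ :- (x :* (con (+ 3) :+ s)))) (λ _ → refl) S xₛ ⟩
    const (+ 4) ⊛ (1ₛ ⊕ S ⊕ neg (xₛ ⊛ (const (+ 3) ⊕ S))) ∎
    where open ≐-Reasoning

  -- With S² = 1 - 4x the left-hand side is (1 + S)³ S⁵ 𝐕.
  closedForm : oneMinus4x ⊛ (oneMinus4x ⊕ S) ⊛ (oneMinus4x ⊕ S) ⊛ (oneMinus4x ⊕ S) ⊛ 𝐕
               ≐ (+ 8) · X (const (+ 1) ⊕ S ⊖ X (const (+ 3) ⊕ S))
  closedForm = begin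
    oneMinus4x ⊛ (oneMinus4x ⊕ S) ⊛ (oneMinus4x ⊕ S) ⊛ (oneMinus4x ⊕ S) ⊛ 𝐕
      ≈⟨ ⊛-cong (⊛-cong (⊛-cong (⊛-cong S²≐′ (plusS S²≐′)) (plusS S²≐′)) (plusS S²≐′)) (≐-refl {𝐕}) ⟩
    S ⊛ S ⊛ (S ⊛ S ⊕ S) ⊛ (S ⊛ S ⊕ S) ⊛ (S ⊛ S ⊕ S) ⊛ 𝐕
      ≈⟨ solve 2 (λ s v → s :* s :* (s :* s :+ s) :* (s :* s :+ s) :* (s :* s :+ s) :* v
                       := (con (+ 1) :+ s) :* (con (+ 1) :+ s) :* (con (+ 1) :+ s) :* (s :* (s :* s) :* (s :* s) :* v))
                 (λ _ → refl) S 𝐕 ⟩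
    (1ₛ ⊕ S) ⊛ (1ₛ ⊕ S) ⊛ (1ₛ ⊕ S) ⊛ (S ⊛ (S ⊛ S) ⊛ (S ⊛ S) ⊛ 𝐕)
      ≈⟨ ⊛-cong one+S-cubed S⁵-⊛𝐕 ⟩
    const (+ 4) ⊛ F ⊛ (const (+ 2) ⊛ xₛ)
      ≈⟨ solve 2 (λ f x → con (+ 4) :* f :* (con (+ 2) :* x) := con (+ 8) :* x :* f) (λ _ → refl) F xₛ ⟩
    const (+ 8) ⊛ xₛ ⊛ F
      ≈⟨ ≐-sym {(+ 8) · X (const (+ 1) ⊕ S ⊖ X (const (+ 3) ⊕ S))} unfold-rhs ⟩
    (+ 8) · X (const (+ 1) ⊕ S ⊖ X (const (+ 3) ⊕ S)) ∎
    where
    open ≐-Reasoning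
    F : Series
    F = 1ₛ ⊕ S ⊕ neg (xₛ ⊛ (const (+ 3) ⊕ S))
    S²≐′ : oneMinus4x ≐ S ⊛ S
    S²≐′ = ≐-sym {S ⊛ S} S²≐
    plusS : ∀ {f g} → f ≐ g → f ⊕ S ≐ g ⊕ S
    plusS f≐g = ⊕-cong f≐g (≐-refl {S})
    unfold-rhs : (+ 8) · X (const (+ 1) ⊕ S ⊖ X (const (+ 3) ⊕ S)) ≐ const (+ 8) ⊛ xₛ ⊛ F
    unfold-rhs = ≐-trans {(+ 8) · X (const (+ 1) ⊕ S ⊖ X (const (+ 3) ⊕ S))} (·X≐ (+ 8) _)
      (⊛-cong (≐-refl {const (+ 8) ⊛ xₛ}) (λ k → cong (λ t → const (+ 1) k + S k + ℤ.- t) (X≐xₛ⊛ (const (+ 3) ⊕ S) k)))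

proposition6p4 :
    (𝐕 ≐ (+ 2) · X 𝐕
          ⊕ (+ 2) · X (X (𝐌₁ ⊛ 𝒱))
          ⊕ (+ 2) · X (X (ℳ₁ ⊛ 𝐕))
          ⊕ (+ 2) · X (X (𝒱 ⊛ ∂ (X ℳ₁)))
          ⊕ (+ 2) · X 𝐍
          ⊕ (+ 2) · X (∂ (X 𝒩)))
    × (∀ (S : Series) → IsSqrt1m4x S →
         oneMinus4x ⊛ (oneMinus4x ⊕ S) ⊛ (oneMinus4x ⊕ S) ⊛ (oneMinus4x ⊕ S) ⊛ 𝐕
           ≐ (+ 8) · X (const (+ 1) ⊕ S ⊖ X (const (+ 3) ⊕ S)))
proposition6p4 = functionalEquation , closedForm
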